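{- Let $G=\langle x,y:~x^n=y^2=e,~yxy=x^{ -1}\rangle$, $A=\langle x\rangle$, $B=\langle y\rangle$, let $A_0\leq A$ with $|A:A_0|=m\geq 2$ and $|A_0|=l$, and $G_0=A_0B$. Let $D$ be a difference set in $A_0$ with parameters $(l,k,2k-l+2)$, where $k=\frac{2l-1-\sqrt{8l-7}}{2}$, let $T=A_0^\#\cup yD\cup(G\setminus G_0)$ and $\Delta=\mathrm{Cay}(G,T)$. Then the WL-closure of $\Delta$ is the S-ring over $G$ whose basic sets are exactly $X_0=\{e\}$, $X_1=A_0^\#$, $X_2=yD$, $X_3=y(A_0\setminus D)$, $X_4=G\setminus G_0$. In particular, the WL-rank of $\Delta$ equals $5$.
   Context: $\mathrm{Cay}(G,S)$ has vertex set $G$ and edges $\{g,sg\}$. A difference set with parameters $(v,k,\lambda)$ in a group $H$ of order $v$ is a $k$-subset $D$ such that every element of $H\setminus\{e\}$ is $d_1^{ -1}d_2$ ($d_1,d_2\in D$) in exactly $\lambda>0$ ways. For $X\subseteq G$, $\underline{X}=\sum_{x\in X}x$. An S-ring over $G$ is a subring $\mathcal{A}\subseteq\mathbb{Z}G$ spanned by $\underline{X}$, $X$ ranging over a partition of $G$ (basic sets) containing $\{e\}$ and closed under inversion; its rank is the number of basic sets. The WL-closure of $\mathrm{Cay}(G,S)$ is the smallest S-ring over $G$ in which $S$ is a union of basic sets; the WL-rank is its rank. -}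

module Defs where

open import Data.Nat using (ℕ; _+_; _*_; _∸_; _<_; NonZero)
open import Data.Nat.DivMod using (_mod_)
open import Data.Bool using (Bool; true; false; _∧_; _∨_; not; _xor_; if_then_else_)
open import Data.Fin using (Fin; toℕ; zero; suc)
open import Data.Fin.Properties using () renaming (_≟_ to _≟F_)
open import Data.Product using (Σ; _×_; _,_; proj₁; proj₂; ∃)
open import Data.Sum using (_⊎_)
open import Data.List using (List; []; _∷_; map; length; filter; allFin; cartesianProduct; concatMap; foldr)
open import Relation.Nullary using (¬_)
open import Relation.Nullary.Decidable using (⌊_⌋)
open import Relation.Binary.PropositionalEquality using (_≡_)
open import Data.Bool.Properties using () renaming (_≟_ to _≟B_)

-- Cyclic group Z_n = <x>, written additively on Fin n (i ↦ x^i)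

module _ (n : ℕ) .{{_ : NonZero n}} where

  zeroC : Fin n
  zeroC = 0 mod n

  _+C_ : Fin n → Fin n → Fin n
  i +C j = (toℕ i + toℕ j) mod n

  negC : Fin n → Fin n
  negC i = (n ∸ toℕ i) mod n

  eqC : Fin n → Fin n → Bool
  eqC i j = ⌊ i ≟F j ⌋

  allC : List (Fin n)
  allC = allFin n

  -- Dihedral group G = <x,y : x^n = y^2 = e, yxy = x^{-1}>.
  -- The pair (b , i) stands for the element y^b x^i.
  Dih : Set
  Dih = Bool × Fin n

  eD : Dih
  eD = false , zeroC

  -- y^b x^i · y^c x^j = y^(b+c) x^(±i + j), using x^i y = y x^{-i}
  mulD : Dih → Dih → Dih
  mulD (b , i) (c , j) = (b xor c) , ((if c then negC i else i) +C j)

  invD : Dih → Dih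
  invD (false , i) = false , negC i
  invD (true , i) = true , i

  eqD : Dih → Dih → Bool
  eqD (b , i) (c , j) = ⌊ b ≟B c ⌋ ∧ eqC i j

  allD : List Dih
  allD = concatMap (λ b → map (λ i → (b , i)) allC) (false ∷ true ∷ [])

  SubC : Set
  SubC = Fin n → Bool

  SubD : Set
  SubD = Dih → Bool

  sizeC : SubC → ℕ
  sizeC P = length (filter (λ i → P i ≟B true) allC)

  record IsSubgroupA (H : SubC) : Set where
    field
      hasZero : H zeroC ≡ true
      closed+ : ∀ i j → H i ≡ true → H j ≡ true → H (i +C j) ≡ true
      closedNeg : ∀ i → H i ≡ true → H (negC i) ≡ true

  repCount : SubC → Fin n → ℕ
  repCount D a = length (filter (λ p → (D (proj₁ p) ∧ D (proj₂ p) ∧ eqC (negC (proj₁ p) +C proj₂ p) a) ≟B true)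
                                (cartesianProduct allC allC))

  record IsDifferenceSet (H D : SubC) (v k lam : ℕ) : Set where
    field
      H-subgroup : IsSubgroupA H
      H-order : sizeC H ≡ v
      D⊆H : ∀ i → D i ≡ true → H i ≡ true
      D-size : sizeC D ≡ k
      λ-pos : 0 < lam
      reps : ∀ a → H a ≡ true → eqC a zeroC ≡ false → repCount D a ≡ lam

  -- coefficient of g in the product X̲ · Y̲ in ℤG
  prodCoeff : SubD → SubD → Dih → ℕ
  prodCoeff X Y g = length (filter (λ p → (X (proj₁ p) ∧ Y (proj₂ p) ∧ eqD (mulD (proj₁ p) (proj₂ p)) g) ≟B true)
                                   (cartesianProduct allD allD))

  sumFin : (r : ℕ) → (Fin r → ℕ) → ℕ
  sumFin r f = foldr _+_ 0 (map f (allFin r))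

  indic : Bool → ℕ
  indic true = 1
  indic false = 0

  record IsSRing (r : ℕ) (X : Fin r → SubD) : Set where
    field
      nonempty : ∀ t → Σ Dih (λ g → X t g ≡ true)
      cover : ∀ g → Σ (Fin r) (λ t → X t g ≡ true)
      disjoint : ∀ s t g → X s g ≡ true → X t g ≡ true → s ≡ t
      identity : Σ (Fin r) (λ t → ∀ g → X t g ≡ eqD g eD)
      inverse : ∀ s → Σ (Fin r) (λ t → ∀ g → X t g ≡ X s (invD g))
      product : ∀ s t → Σ (Fin r → ℕ) (λ c →
                  ∀ g → prodCoeff (X s) (X t) g ≡ sumFin r (λ u → c u * indic (X u g)))

  IsUnionOf : (r : ℕ) → (Fin r → SubD) → SubD → Set
  IsUnionOf r X S = ∀ g → S g ≡ true → Σ (Fin r) (λ t → X t g ≡ true × (∀ h → X t h ≡ true → S h ≡ true))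

  SRing⊆ : (r : ℕ) → (Fin r → SubD) → (r' : ℕ) → (Fin r' → SubD) → Set
  SRing⊆ r X r' Y = ∀ t → IsUnionOf r' Y (X t)

  -- X (of rank r) is the WL-closure of Cay(G,S): the smallest S-ring over G
  -- in which S is a union of basic sets.
  record IsWLClosure (S : SubD) (r : ℕ) (X : Fin r → SubD) : Set where
    field
      sring : IsSRing r X
      contains : IsUnionOf r X S
      smallest : ∀ r' (Y : Fin r' → SubD) → IsSRing r' Y → IsUnionOf r' Y S → SRing⊆ r X r' Y

  module _ (A0 D : SubC) where
    Tset : SubD
    Tset (false , i) = (A0 i ∧ not (eqC i zeroC)) ∨ not (A0 i)
    Tset (true , i) = D i ∨ not (A0 i)

    X0 X1 X2 X3 X4 : SubD
    X0 g = eqD g eD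
    X1 (false , i) = A0 i ∧ not (eqC i zeroC)
    X1 (true , i) = false
    X2 (false , i) = false
    X2 (true , i) = D i
    X3 (false , i) = false
    X3 (true , i) = A0 i ∧ not (D i)
    X4 (b , i) = not (A0 i)

    basicSets : Fin 5 → SubD
    basicSets zero = X0
    basicSets (suc zero) = X1
    basicSets (suc (suc zero)) = X2
    basicSets (suc (suc (suc zero))) = X3
    basicSets (suc (suc (suc (suc zero)))) = X4

-- The five sets partition G, are closed under inversion, and every product X_s X_t is computed
-- explicitly. For g = y^b x^c the convolution over G splits into correlations over ℤ/n of rotation
-- and reflection parts along i ↦ i + c and i ↦ −i + c. For c ∈ A0 these maps preserve A0, so each
-- correlation is the size of a basic set, except those of D with its translates, which are λ by the
-- difference-set property; products with G ∖ G0 only see the coset decomposition of G0.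
-- Minimality: in an S-ring in which T is a union of basic sets, so are {e} and X3 = G ∖ (T ∪ {e}),
-- and so is the support of any product of such unions. The support of X3 X3 is A0, because its
-- coefficient on A0^# is |A0 ∖ D| − (k − λ) = 2 when λ + l = 2k + 2; this yields X1. The support of
-- X1 X3 is yA0, which yields X2 = yA0 ∖ X3, and finally X4 = T ∖ (X1 ∪ X2).
module Submission where

open import Defs
open import Data.Nat using (ℕ; zero; suc; >-nonZero⁻¹; _+_; _*_; _∸_; _≤_; _<_; NonZero; z≤n; s≤s)
open import Data.Nat.Properties
  using (+-comm; +-assoc; n∸n≡0; m+n∸m≡n; +-identityʳ; *-identityʳ; *-zeroʳ; m+n∸n≡m; m∸n+n≡m; +-cancelˡ-≡
        ; *-distribˡ-+; *-commutativeSemigroup; ≤-trans; ≤-reflexive; <⇒≤; <-irrefl; m≤n+m; m<m+n; *-monoˡ-≤; +-mono-≤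
        ; +-*-semiring; module ≤-Reasoning)
open import Data.Nat.Tactic.RingSolver using (solve-∀)
open import Data.Nat.DivMod using (_%_; _mod_; m%n<n; m%n%n≡m%n; %-distribˡ-+; m<n⇒m%n≡m; n%n≡0)
open import Algebra.Properties.Semiring.Sum +-*-semiring
  using (sum; sum-syntax; sum-cong-≗; ∑-distrib-+; ∑-comm; ∑-permute; sum-replicate-zero; *-distribˡ-sum; *-distribʳ-sum)
open import Data.Bool using (Bool; true; false; _∧_; _∨_; not)
open import Data.Bool.Properties using (∧-zeroʳ; ∧-identityʳ; ∧-comm; ∨-zeroʳ; not-involutive) renaming (_≟_ to _≟B_)
open import Data.Fin using (Fin; zero; suc; toℕ)
open import Data.Fin.Properties using (toℕ-fromℕ<; toℕ-injective; toℕ<n; suc-injective) renaming (_≟_ to _≟F_)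
open import Data.Fin.Permutation using (permutation)
open import Data.Fin.Patterns using (0F; 1F; 2F; 3F; 4F)
open import Data.Product using (Σ; ∃; _×_; _,_; proj₁; proj₂)
open import Data.List using (List; []; _∷_; map; length; filter; tabulate; cartesianProduct; _++_)
open import Data.List.Properties using (map-++; map-∘)
open import Data.Nat.ListAction.Properties using (sum-++)
import Data.Nat.ListAction as ListAction
open import Data.Empty using (⊥; ⊥-elim)
open import Function using (_∘_; _$_)
open import Level using (0ℓ)
open import Algebra.Bundles using (AbelianGroup)
open import Algebra.Properties.CommutativeSemigroup *-commutativeSemigroup using (interchange)
open import Algebra.Structures using (IsAbelianGroup)
open import Relation.Nullary using (¬_; yes; no)
open import Relation.Nullary.Decidable using (⌊_⌋)
open import Relation.Binary.PropositionalEquality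

⌊≟⌋-refl : ∀ {r} (i : Fin r) → ⌊ i ≟F i ⌋ ≡ true
⌊≟⌋-refl i with i ≟F i
... | yes _ = refl
... | no i≢i = ⊥-elim (i≢i refl)

≡⇒⌊≟⌋ : ∀ {r} {i j : Fin r} → i ≡ j → ⌊ i ≟F j ⌋ ≡ true
≡⇒⌊≟⌋ {i = i} refl = ⌊≟⌋-refl i

⌊≟⌋-≢ : ∀ {r} {i j : Fin r} → ¬ (i ≡ j) → ⌊ i ≟F j ⌋ ≡ false
⌊≟⌋-≢ {i = i} {j} i≢j with i ≟F j
... | yes i≡j = ⊥-elim (i≢j i≡j)
... | no _ = refl

⌊≟⌋-sound : ∀ {r} {i j : Fin r} → ⌊ i ≟F j ⌋ ≡ true → i ≡ j
⌊≟⌋-sound {i = i} {j} eq with i ≟F j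
... | yes i≡j = i≡j

⟦_⟧ : Bool → ℕ
⟦ true ⟧ = 1
⟦ false ⟧ = 0

⟦∧⟧ : ∀ a b → ⟦ a ∧ b ⟧ ≡ ⟦ a ⟧ * ⟦ b ⟧
⟦∧⟧ false b = refl
⟦∧⟧ true b = sym (+-identityʳ ⟦ b ⟧)

⟦∧⟧+⟦∧not⟧ : ∀ a b → ⟦ a ∧ b ⟧ + ⟦ a ∧ not b ⟧ ≡ ⟦ a ⟧
⟦∧⟧+⟦∧not⟧ false b = refl
⟦∧⟧+⟦∧not⟧ true false = refl
⟦∧⟧+⟦∧not⟧ true true = refl

⟦∧false⟧ : ∀ a {b} → b ≡ false → ⟦ a ∧ b ⟧ ≡ 0
⟦∧false⟧ a refl = cong ⟦_⟧ (∧-zeroʳ a)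

⟦∧true⟧ : ∀ a {b} → b ≡ true → ⟦ a ∧ b ⟧ ≡ ⟦ a ⟧
⟦∧true⟧ a refl = cong ⟦_⟧ (∧-identityʳ a)

true≢false : ∀ {b : Bool} → b ≡ true → b ≡ false → ⊥
true≢false refl ()

Bool-ext : ∀ {a b : Bool} → (a ≡ true → b ≡ true) → (b ≡ true → a ≡ true) → a ≡ b
Bool-ext {false} {false} _ _ = refl
Bool-ext {false} {true} _ b⇒a = b⇒a refl
Bool-ext {true} {false} a⇒b _ = sym (a⇒b refl)
Bool-ext {true} {true} _ _ = refl

∧-trueˡ : ∀ {a b : Bool} → a ∧ b ≡ true → a ≡ true
∧-trueˡ {true} _ = refl

∧-not-true : ∀ {a b : Bool} → a ∧ not b ≡ true → b ≡ false
∧-not-true {true} {false} _ = refl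

≢true⇒≡false : ∀ {b : Bool} → ¬ (b ≡ true) → b ≡ false
≢true⇒≡false {false} _ = refl
≢true⇒≡false {true} b≢true = ⊥-elim (b≢true refl)

contra-≡false : ∀ {a b : Bool} → (a ≡ true → b ≡ true) → b ≡ false → a ≡ false
contra-≡false {false} _ _ = refl
contra-≡false {true} a⇒b b≡false = sym (trans (sym b≡false) (a⇒b refl))

∧-≡false : ∀ {a b : Bool} → (a ≡ true → b ≡ false) → a ∧ b ≡ false
∧-≡false {false} _ = refl
∧-≡false {true} a⇒¬b = a⇒¬b refl

∧-≡ˡ : ∀ {a b : Bool} → (a ≡ true → b ≡ true) → a ∧ b ≡ a
∧-≡ˡ {false} _ = refl
∧-≡ˡ {true} a⇒b = a⇒b refl

∧-≡ʳ : ∀ {a b : Bool} → (b ≡ true → a ≡ true) → a ∧ b ≡ b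
∧-≡ʳ {a} {false} _ = ∧-zeroʳ a
∧-≡ʳ {a} {true} b⇒a = trans (∧-identityʳ a) (b⇒a refl)

+-≡ˡ : ∀ {a b v} → a ≡ v → b ≡ 0 → a + b ≡ v
+-≡ˡ {a} refl refl = +-identityʳ a

+-≡ʳ : ∀ {a b v} → a ≡ 0 → b ≡ v → a + b ≡ v
+-≡ʳ refl refl = refl

∸-from-+ : ∀ {a b v w} → a + b ≡ v → b ≡ w → a ≡ v ∸ w
∸-from-+ {a} {b} refl refl = sym (m+n∸n≡m a b)

isPositive : ℕ → Bool
isPositive zero = false
isPositive (suc _) = true

sum-zero : ∀ {r} {f : Fin r → ℕ} → (∀ i → f i ≡ 0) → sum f ≡ 0
sum-zero {r} f≡0 = trans (sum-cong-≗ f≡0) (sum-replicate-zero r)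

sum-single : ∀ {r} (f : Fin r → ℕ) (j : Fin r) → (∀ i → ¬ (i ≡ j) → f i ≡ 0) → sum f ≡ f j
sum-single {suc r} f zero f≡0 =
  trans (cong (f zero +_) (sum-zero (λ i → f≡0 (suc i) (λ ())))) (+-identityʳ _)
sum-single {suc r} f (suc j) f≡0 =
  cong₂ _+_ (f≡0 zero (λ ())) (sum-single (f ∘ suc) j (λ i i≢j → f≡0 (suc i) (i≢j ∘ suc-injective)))

sum-indicator : ∀ {r} (c : Fin r → ℕ) (B : Fin r → Bool) j → B j ≡ true → (∀ u → B u ≡ true → u ≡ j) →
                ∑[ u < r ] (c u * ⟦ B u ⟧) ≡ c j
sum-indicator c B j Bj unique = trans (sum-single _ j off-j) (trans (cong (λ b → c j * ⟦ b ⟧) Bj) (*-identityʳ (c j)))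
  where
  off-j : ∀ u → ¬ (u ≡ j) → c u * ⟦ B u ⟧ ≡ 0
  off-j u u≢j = trans (cong (λ b → c u * ⟦ b ⟧) (≢true⇒≡false (u≢j ∘ unique u))) (*-zeroʳ (c u))

sum-witness : ∀ {r} (P : Fin r → Bool) → ¬ (∑[ i < r ] ⟦ P i ⟧ ≡ 0) → ∃ λ i → P i ≡ true
sum-witness {zero} P sum≢0 = ⊥-elim (sum≢0 refl)
sum-witness {suc r} P sum≢0 with P zero in P0
... | true = zero , P0
... | false = let i , Pi = sum-witness (P ∘ suc) sum≢0 in suc i , Pi

listSum : {A : Set} → List A → (A → ℕ) → ℕ
listSum xs f = ListAction.sum (map f xs)

length-filter : {A : Set} (B : A → Bool) (xs : List A) →
                length (filter (λ x → B x ≟B true) xs) ≡ listSum xs (⟦_⟧ ∘ B)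
length-filter B [] = refl
length-filter B (x ∷ xs) with B x
... | true = cong suc (length-filter B xs)
... | false = length-filter B xs

listSum-++ : {A : Set} (xs ys : List A) (f : A → ℕ) → listSum (xs ++ ys) f ≡ listSum xs f + listSum ys f
listSum-++ xs ys f = trans (cong ListAction.sum (map-++ f xs ys)) (sum-++ (map f xs) (map f ys))

listSum-map : {A B : Set} (h : A → B) (xs : List A) (f : B → ℕ) → listSum (map h xs) f ≡ listSum xs (f ∘ h)
listSum-map h xs f = cong ListAction.sum (sym (map-∘ xs))

listSum-tabulate : {A : Set} {r : ℕ} (g : Fin r → A) (f : A → ℕ) → listSum (tabulate g) f ≡ sum (f ∘ g)
listSum-tabulate {r = zero} g f = refl
listSum-tabulate {r = suc r} g f = cong (f (g zero) +_) (listSum-tabulate (g ∘ suc) f)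

listSum-cartesianProduct : {A B : Set} (xs : List A) (ys : List B) (f : A × B → ℕ) →
                           listSum (cartesianProduct xs ys) f ≡ listSum xs (λ x → listSum ys (λ y → f (x , y)))
listSum-cartesianProduct [] ys f = refl
listSum-cartesianProduct (x ∷ xs) ys f =
  trans (listSum-++ (map (x ,_) ys) (cartesianProduct xs ys) f)
        (cong₂ _+_ (listSum-map (x ,_) ys f) (listSum-cartesianProduct xs ys f))

sum-*-sum : ∀ {r s} (f : Fin r → ℕ) (g : Fin s → ℕ) → sum f * sum g ≡ ∑[ a < r ] ∑[ b < s ] (f a * g b)
sum-*-sum f g = trans (*-distribʳ-sum (sum g) f) (sum-cong-≗ (λ a → *-distribˡ-sum (f a) g))

sum-ones : ∀ r → ∑[ i < r ] 1 ≡ r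
sum-ones zero = refl
sum-ones (suc r) = cong suc (sum-ones r)

e≡d+2 : ∀ {e k l d lam} → k + e ≡ l → d + lam ≡ k → lam + l ≡ 2 * k + 2 → e ≡ d + 2
e≡d+2 {e} {d = d} {lam} refl refl eq = +-cancelˡ-≡ (d + lam + lam) e (d + 2) (trans (lhs e d lam) (trans eq (rhs d lam)))
  where
  lhs : ∀ e d lam → d + lam + lam + e ≡ lam + (d + lam + e)
  lhs = solve-∀
  rhs : ∀ d lam → 2 * (d + lam) + 2 ≡ d + lam + lam + (d + 2)
  rhs = solve-∀

module ZMod (n : ℕ) .{{_ : NonZero n}} where

  private
    infixl 6 _⊕_
    _⊕_ : Fin n → Fin n → Fin n
    _⊕_ = _+C_ n
    𝟘 : Fin n
    𝟘 = zeroC n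
    ⊖_ : Fin n → Fin n
    ⊖_ = negC n

  toℕ-mod : ∀ a → toℕ (a mod n) ≡ a % n
  toℕ-mod a = toℕ-fromℕ< (m%n<n a n)

  %-absorbˡ : ∀ a b → (a % n + b) % n ≡ (a + b) % n
  %-absorbˡ a b = begin
    (a % n + b) % n           ≡⟨ %-distribˡ-+ (a % n) b n ⟩
    (a % n % n + b % n) % n   ≡⟨ cong (λ x → (x + b % n) % n) (m%n%n≡m%n a n) ⟩
    (a % n + b % n) % n       ≡⟨ %-distribˡ-+ a b n ⟨
    (a + b) % n               ∎
    where open ≡-Reasoning

  toℕ-⊕ : ∀ i j → toℕ (i ⊕ j) ≡ (toℕ i + toℕ j) % n
  toℕ-⊕ i j = toℕ-mod (toℕ i + toℕ j)

  toℕ-𝟘 : toℕ 𝟘 ≡ 0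
  toℕ-𝟘 = trans (toℕ-mod 0) (m<n⇒m%n≡m (>-nonZero⁻¹ n))

  ⊕-assoc : ∀ i j k → (i ⊕ j) ⊕ k ≡ i ⊕ (j ⊕ k)
  ⊕-assoc i j k = toℕ-injective (begin
    toℕ ((i ⊕ j) ⊕ k)                    ≡⟨ toℕ-⊕ (i ⊕ j) k ⟩
    (toℕ (i ⊕ j) + toℕ k) % n            ≡⟨ cong (λ x → (x + toℕ k) % n) (toℕ-⊕ i j) ⟩
    ((toℕ i + toℕ j) % n + toℕ k) % n    ≡⟨ %-absorbˡ (toℕ i + toℕ j) (toℕ k) ⟩
    (toℕ i + toℕ j + toℕ k) % n          ≡⟨ cong (_% n) (+-assoc (toℕ i) (toℕ j) (toℕ k)) ⟩
    (toℕ i + (toℕ j + toℕ k)) % n        ≡⟨ cong (_% n) (+-comm (toℕ i) (toℕ j + toℕ k)) ⟩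
    (toℕ j + toℕ k + toℕ i) % n          ≡⟨ %-absorbˡ (toℕ j + toℕ k) (toℕ i) ⟨
    ((toℕ j + toℕ k) % n + toℕ i) % n    ≡⟨ cong (λ x → (x + toℕ i) % n) (toℕ-⊕ j k) ⟨
    (toℕ (j ⊕ k) + toℕ i) % n            ≡⟨ cong (_% n) (+-comm (toℕ (j ⊕ k)) (toℕ i)) ⟩
    (toℕ i + toℕ (j ⊕ k)) % n            ≡⟨ toℕ-⊕ i (j ⊕ k) ⟨
    toℕ (i ⊕ (j ⊕ k))                    ∎)
    where open ≡-Reasoning

  ⊕-comm : ∀ i j → i ⊕ j ≡ j ⊕ i
  ⊕-comm i j = cong (_mod n) (+-comm (toℕ i) (toℕ j))

  ⊕-identityˡ : ∀ i → 𝟘 ⊕ i ≡ i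
  ⊕-identityˡ i = toℕ-injective (begin
    toℕ (𝟘 ⊕ i)              ≡⟨ toℕ-⊕ 𝟘 i ⟩
    (toℕ 𝟘 + toℕ i) % n      ≡⟨ cong (λ x → (x + toℕ i) % n) toℕ-𝟘 ⟩
    toℕ i % n                ≡⟨ m<n⇒m%n≡m (toℕ<n i) ⟩
    toℕ i                    ∎)
    where open ≡-Reasoning

  ⊕-inverseˡ : ∀ i → ⊖ i ⊕ i ≡ 𝟘
  ⊕-inverseˡ i = toℕ-injective (begin
    toℕ (⊖ i ⊕ i)                    ≡⟨ toℕ-⊕ (⊖ i) i ⟩
    (toℕ (⊖ i) + toℕ i) % n          ≡⟨ cong (λ x → (x + toℕ i) % n) (toℕ-mod (n ∸ toℕ i)) ⟩
    ((n ∸ toℕ i) % n + toℕ i) % n    ≡⟨ %-absorbˡ (n ∸ toℕ i) (toℕ i) ⟩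
    (n ∸ toℕ i + toℕ i) % n          ≡⟨ cong (_% n) (m∸n+n≡m (<⇒≤ (toℕ<n i))) ⟩
    n % n                            ≡⟨ n%n≡0 n ⟩
    0                                ≡⟨ toℕ-𝟘 ⟨
    toℕ 𝟘                            ∎)
    where open ≡-Reasoning

  isAbelianGroup : IsAbelianGroup _≡_ _⊕_ 𝟘 ⊖_
  isAbelianGroup = record
    { isGroup = record
      { isMonoid = record
        { isSemigroup = record
          { isMagma = record { isEquivalence = isEquivalence ; ∙-cong = cong₂ _⊕_ }
          ; assoc = ⊕-assoc }
        ; identity = ⊕-identityˡ , λ i → trans (⊕-comm i 𝟘) (⊕-identityˡ i) }
      ; inverse = ⊕-inverseˡ , λ i → trans (⊕-comm i (⊖ i)) (⊕-inverseˡ i)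
      ; ⁻¹-cong = cong ⊖_ }
    ; comm = ⊕-comm }

  abelianGroup : AbelianGroup 0ℓ 0ℓ
  abelianGroup = record { isAbelianGroup = isAbelianGroup }

module Dihedral (n : ℕ) .{{_ : NonZero n}} where

  open AbelianGroup (ZMod.abelianGroup n)
    using (assoc; comm; identityˡ; identityʳ; inverseˡ)
    renaming (_∙_ to infixl 6 _⊕_; ε to 𝟘; _⁻¹ to ⊖_)
  open import Algebra.Properties.AbelianGroup (ZMod.abelianGroup n)
    using (⁻¹-involutive; ε⁻¹≈ε; \\-leftDividesˡ; \\-leftDividesʳ; //-rightDividesˡ; //-rightDividesʳ; ⁻¹-∙-comm)

  eqC-⊖𝟘 : ∀ c → eqC n (⊖ c) 𝟘 ≡ eqC n c 𝟘
  eqC-⊖𝟘 c = Bool-ext (λ eq → ≡⇒⌊≟⌋ (trans (sym (⁻¹-involutive c)) (trans (cong ⊖_ (⌊≟⌋-sound eq)) ε⁻¹≈ε)))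
                      (λ eq → ≡⇒⌊≟⌋ (trans (cong ⊖_ (⌊≟⌋-sound eq)) ε⁻¹≈ε))

  eqD-refl : ∀ g → eqD n g g ≡ true
  eqD-refl (false , i) = ⌊≟⌋-refl i
  eqD-refl (true , i) = ⌊≟⌋-refl i

  eqD-sound : ∀ {g h} → eqD n g h ≡ true → g ≡ h
  eqD-sound {false , i} {false , j} eq = cong (false ,_) (⌊≟⌋-sound eq)
  eqD-sound {true , i} {true , j} eq = cong (true ,_) (⌊≟⌋-sound eq)

  mulD-cancelˡ : ∀ p q → mulD n (invD n p) (mulD n p q) ≡ q
  mulD-cancelˡ (false , i) (false , j) = cong (false ,_) (\\-leftDividesʳ i j)
  mulD-cancelˡ (false , i) (true , j) =
    cong (true ,_) (trans (cong (_⊕ (⊖ i ⊕ j)) (⁻¹-involutive i)) (\\-leftDividesˡ i j))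
  mulD-cancelˡ (true , i) (false , j) = cong (false ,_) (\\-leftDividesʳ i j)
  mulD-cancelˡ (true , i) (true , j) = cong (true ,_) (\\-leftDividesˡ i j)

  mulD-cancelʳ : ∀ p g → mulD n p (mulD n (invD n p) g) ≡ g
  mulD-cancelʳ (false , i) (false , j) = cong (false ,_) (\\-leftDividesˡ i j)
  mulD-cancelʳ (false , i) (true , j) =
    cong (true ,_) (trans (cong (λ x → ⊖ i ⊕ (x ⊕ j)) (⁻¹-involutive i)) (\\-leftDividesʳ i j))
  mulD-cancelʳ (true , i) (false , j) = cong (false ,_) (\\-leftDividesʳ i j)
  mulD-cancelʳ (true , i) (true , j) = cong (true ,_) (\\-leftDividesˡ i j)

  eD⁻¹-mul : ∀ g → mulD n (invD n (eD n)) g ≡ g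
  eD⁻¹-mul (false , c) = cong (false ,_) (trans (cong (_⊕ c) ε⁻¹≈ε) (identityˡ c))
  eD⁻¹-mul (true , c) = cong (true ,_) (trans (cong (_⊕ c) (⁻¹-involutive 𝟘)) (identityˡ c))

  mulD-inverseˡ : ∀ g → mulD n (invD n g) g ≡ eD n
  mulD-inverseˡ (false , c) = cong (false ,_) (inverseˡ c)
  mulD-inverseˡ (true , c) = cong (false ,_) (inverseˡ c)

  mulD-identityʳ : ∀ p → mulD n p (eD n) ≡ p
  mulD-identityʳ (false , i) = cong (false ,_) (identityʳ i)
  mulD-identityʳ (true , i) = cong (true ,_) (identityʳ i)

  sumD : (Dih n → ℕ) → ℕ
  sumD F = ∑[ i < n ] F (false , i) + ∑[ i < n ] F (true , i)

  sumD-cong : ∀ {F F′ : Dih n → ℕ} → (∀ g → F g ≡ F′ g) → sumD F ≡ sumD F′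
  sumD-cong F≡F′ = cong₂ _+_ (sum-cong-≗ (λ i → F≡F′ (false , i))) (sum-cong-≗ (λ i → F≡F′ (true , i)))

  sumD-zero : ∀ {F : Dih n → ℕ} → (∀ g → F g ≡ 0) → sumD F ≡ 0
  sumD-zero F≡0 = cong₂ _+_ (sum-zero (λ i → F≡0 (false , i))) (sum-zero (λ i → F≡0 (true , i)))

  sumD-single : ∀ (F : Dih n → ℕ) h → (∀ g → ¬ (g ≡ h) → F g ≡ 0) → sumD F ≡ F h
  sumD-single F (false , c) F≡0 =
    trans (cong₂ _+_ (sum-single _ c (λ i i≢c → F≡0 (false , i) (i≢c ∘ cong proj₂)))
                     (sum-zero (λ i → F≡0 (true , i) (λ ()))))
          (+-identityʳ _)
  sumD-single F (true , c) F≡0 =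
    cong₂ _+_ (sum-zero (λ i → F≡0 (false , i) (λ ())))
              (sum-single _ c (λ i i≢c → F≡0 (true , i) (i≢c ∘ cong proj₂)))

  listSum-allD : ∀ F → listSum (allD n) F ≡ sumD F
  listSum-allD F = begin
    listSum (allD n) F
      ≡⟨ listSum-++ (map (false ,_) (allC n)) (map (true ,_) (allC n) ++ []) F ⟩
    listSum (map (false ,_) (allC n)) F + listSum (map (true ,_) (allC n) ++ []) F
      ≡⟨ cong (listSum (map (false ,_) (allC n)) F +_) (listSum-++ (map (true ,_) (allC n)) [] F) ⟩
    listSum (map (false ,_) (allC n)) F + (listSum (map (true ,_) (allC n)) F + 0)
      ≡⟨ cong₂ (λ x y → x + (y + 0)) (listSum-map (false ,_) (allC n) F) (listSum-map (true ,_) (allC n) F) ⟩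
    listSum (allC n) (λ i → F (false , i)) + (listSum (allC n) (λ i → F (true , i)) + 0)
      ≡⟨ cong₂ (λ x y → x + (y + 0)) (listSum-tabulate (λ i → i) (λ i → F (false , i)))
                                     (listSum-tabulate (λ i → i) (λ i → F (true , i))) ⟩
    ∑[ i < n ] F (false , i) + (∑[ i < n ] F (true , i) + 0)
      ≡⟨ cong (∑[ i < n ] F (false , i) +_) (+-identityʳ _) ⟩
    sumD F ∎
    where open ≡-Reasoning

  ∣_∣ᴰ : SubD n → ℕ
  ∣ X ∣ᴰ = sumD (⟦_⟧ ∘ X)

  sumD-distrib-+ : ∀ (F F′ : Dih n → ℕ) → sumD (λ p → F p + F′ p) ≡ sumD F + sumD F′
  sumD-distrib-+ F F′ = begin
    sumD (λ p → F p + F′ p)                     ≡⟨ cong₂ _+_ (∑-distrib-+ (F ∘ (false ,_)) (F′ ∘ (false ,_)))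
                                                             (∑-distrib-+ (F ∘ (true ,_)) (F′ ∘ (true ,_))) ⟩
    (F₀ + F′₀) + (F₁ + F′₁)                     ≡⟨ +-assoc F₀ F′₀ _ ⟩
    F₀ + (F′₀ + (F₁ + F′₁))                     ≡⟨ cong (F₀ +_) (trans (sym (+-assoc F′₀ F₁ F′₁)) (cong (_+ F′₁) (+-comm F′₀ F₁))) ⟩
    F₀ + (F₁ + F′₀ + F′₁)                       ≡⟨ cong (F₀ +_) (+-assoc F₁ F′₀ F′₁) ⟩
    F₀ + (F₁ + (F′₀ + F′₁))                     ≡⟨ +-assoc F₀ F₁ _ ⟨
    sumD F + sumD F′                            ∎
    where
    open ≡-Reasoning
    F₀ = ∑[ i < n ] F (false , i)
    F₁ = ∑[ i < n ] F (true , i)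
    F′₀ = ∑[ i < n ] F′ (false , i)
    F′₁ = ∑[ i < n ] F′ (true , i)

  sumD-∑ : ∀ {r} (F : Fin r → Dih n → ℕ) → sumD (λ p → ∑[ a < r ] F a p) ≡ ∑[ a < r ] sumD (F a)
  sumD-∑ F = trans (cong₂ _+_ (∑-comm (λ i a → F a (false , i))) (∑-comm (λ i a → F a (true , i))))
                   (sym (∑-distrib-+ (λ a → ∑[ i < n ] F a (false , i)) (λ a → ∑[ i < n ] F a (true , i))))

  sumD-*ˡ : ∀ x (F : Dih n → ℕ) → sumD (λ p → x * F p) ≡ x * sumD F
  sumD-*ˡ x F = trans (sym (cong₂ _+_ (*-distribˡ-sum x (F ∘ (false ,_))) (*-distribˡ-sum x (F ∘ (true ,_)))))
                      (sym (*-distribˡ-+ x (∑[ i < n ] F (false , i)) (∑[ i < n ] F (true , i))))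

  sumFin-indicator : ∀ {r} (c : Fin r → ℕ) (B : Fin r → Bool) j → B j ≡ true → (∀ u → B u ≡ true → u ≡ j) →
                     sumFin n r (λ u → c u * indic n (B u)) ≡ c j
  sumFin-indicator {r} c B j Bj unique = begin
    sumFin n r (λ u → c u * indic n (B u))   ≡⟨ listSum-tabulate (λ u → u) (λ u → c u * indic n (B u)) ⟩
    ∑[ u < r ] (c u * indic n (B u))         ≡⟨ sum-cong-≗ (λ u → cong (c u *_) (indic≡⟦⟧ (B u))) ⟩
    ∑[ u < r ] (c u * ⟦ B u ⟧)               ≡⟨ sum-indicator c B j Bj unique ⟩
    c j                                      ∎
    where
    open ≡-Reasoning
    indic≡⟦⟧ : ∀ b → indic n b ≡ ⟦ b ⟧
    indic≡⟦⟧ false = refl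
    indic≡⟦⟧ true = refl

  ∣_∣ : SubC n → ℕ
  ∣ P ∣ = ∑[ i < n ] ⟦ P i ⟧

  sizeC≡∣∣ : ∀ P → sizeC n P ≡ ∣ P ∣
  sizeC≡∣∣ P = trans (length-filter P (allC n)) (listSum-tabulate (λ i → i) (⟦_⟧ ∘ P))

  ∣∣-cong : ∀ {P Q : SubC n} → (∀ i → P i ≡ Q i) → ∣ P ∣ ≡ ∣ Q ∣
  ∣∣-cong P≡Q = sum-cong-≗ (cong ⟦_⟧ ∘ P≡Q)

  ∣∣-split : ∀ (P Q : SubC n) → ∣ (λ i → P i ∧ Q i) ∣ + ∣ (λ i → P i ∧ not (Q i)) ∣ ≡ ∣ P ∣
  ∣∣-split P Q = trans (sym (∑-distrib-+ (λ i → ⟦ P i ∧ Q i ⟧) (λ i → ⟦ P i ∧ not (Q i) ⟧)))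
                       (sum-cong-≗ (λ i → ⟦∧⟧+⟦∧not⟧ (P i) (Q i)))

  ∣∣-remove : ∀ (P : SubC n) j → ∣ (λ i → P i ∧ not (eqC n i j)) ∣ + ⟦ P j ⟧ ≡ ∣ P ∣
  ∣∣-remove P j = begin
    ∣ (λ i → P i ∧ not (eqC n i j)) ∣ + ⟦ P j ⟧            ≡⟨ +-comm _ ⟦ P j ⟧ ⟩
    ⟦ P j ⟧ + ∣ (λ i → P i ∧ not (eqC n i j)) ∣            ≡⟨ cong (_+ ∣ (λ i → P i ∧ not (eqC n i j)) ∣) at-j ⟨
    ∣ (λ i → P i ∧ eqC n i j) ∣ + ∣ (λ i → P i ∧ not (eqC n i j)) ∣ ≡⟨ ∣∣-split P (λ i → eqC n i j) ⟩
    ∣ P ∣                                                  ∎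
    where
    open ≡-Reasoning
    at-j : ∣ (λ i → P i ∧ eqC n i j) ∣ ≡ ⟦ P j ⟧
    at-j = trans (sum-single _ j (λ i i≢j → ⟦∧false⟧ (P i) (⌊≟⌋-≢ i≢j))) (⟦∧true⟧ (P j) (⌊≟⌋-refl j))

  module _ {H : SubC n} (H-subgroup : IsSubgroupA n H) where
    open IsSubgroupA H-subgroup

    H-⊖ : ∀ i → H (⊖ i) ≡ H i
    H-⊖ i = Bool-ext (λ H⊖i → subst (λ x → H x ≡ true) (⁻¹-involutive i) (closedNeg (⊖ i) H⊖i)) (closedNeg i)

    H-cosetˡ : ∀ {a} b → H a ≡ true → H (a ⊕ b) ≡ H b
    H-cosetˡ {a} b Ha = Bool-ext
      (λ Hab → subst (λ x → H x ≡ true) (\\-leftDividesʳ a b) (closed+ (⊖ a) (a ⊕ b) (closedNeg a Ha) Hab))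
      (closed+ a b Ha)

    H-cosetʳ : ∀ {a} b → H a ≡ true → H (b ⊕ a) ≡ H b
    H-cosetʳ b Ha = trans (cong H (comm b _)) (H-cosetˡ b Ha)

  record AffineMap (c : Fin n) : Set where
    field
      to from : Fin n → Fin n
      to-from : ∀ i → to (from i) ≡ i
      from-to : ∀ i → from (to i) ≡ i
      to-𝟘 : to 𝟘 ≡ c
      to-coset : ∀ {H} → IsSubgroupA n H → H c ≡ true → ∀ i → H (to i) ≡ H i

    sum-∘to : ∀ f → sum (f ∘ to) ≡ sum f
    sum-∘to f = sym (∑-permute f (permutation to from to-from from-to))

  translation : ∀ c → AffineMap c
  translation c = record
    { to = _⊕ c ; from = _⊕ ⊖ c
    ; to-from = //-rightDividesˡ c ; from-to = //-rightDividesʳ c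
    ; to-𝟘 = identityˡ c
    ; to-coset = λ H-subgroup Hc i → H-cosetʳ H-subgroup i Hc }

  reflection : ∀ c → AffineMap c
  reflection c = record
    { to = reflect ; from = reflect
    ; to-from = reflect-involutive ; from-to = reflect-involutive
    ; to-𝟘 = trans (cong (_⊕ c) ε⁻¹≈ε) (identityˡ c)
    ; to-coset = λ H-subgroup Hc i → trans (H-cosetʳ H-subgroup (⊖ i) Hc) (H-⊖ H-subgroup i) }
    where
    reflect : Fin n → Fin n
    reflect i = ⊖ i ⊕ c
    reflect-involutive : ∀ i → reflect (reflect i) ≡ i
    reflect-involutive i = begin
      ⊖ (⊖ i ⊕ c) ⊕ c       ≡⟨ cong (_⊕ c) (⁻¹-∙-comm (⊖ i) c) ⟨
      ⊖ ⊖ i ⊕ ⊖ c ⊕ c       ≡⟨ //-rightDividesˡ c (⊖ ⊖ i) ⟩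
      ⊖ ⊖ i                 ≡⟨ ⁻¹-involutive i ⟩
      i                     ∎
      where open ≡-Reasoning

  open AffineMap using (to; from; to-𝟘; to-coset; sum-∘to)

  correlation : ∀ {c} → SubC n → SubC n → AffineMap c → ℕ
  correlation P Q φ = ∣ (λ i → P i ∧ Q (to φ i)) ∣

  _∖_ : SubC n → SubC n → SubC n
  (P ∖ Q) i = P i ∧ not (Q i)

  punctured : SubC n → SubC n
  punctured P i = P i ∧ not (eqC n i 𝟘)

  correlation-emptyˡ : ∀ {c} Q (φ : AffineMap c) → correlation (λ _ → false) Q φ ≡ 0
  correlation-emptyˡ Q φ = sum-replicate-zero n

  correlation-emptyʳ : ∀ {c} P (φ : AffineMap c) → correlation P (λ _ → false) φ ≡ 0
  correlation-emptyʳ P φ = sum-zero (λ i → ⟦∧false⟧ (P i) refl)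

  correlation-self : ∀ P → correlation P P (translation 𝟘) ≡ ∣ P ∣
  correlation-self P = ∣∣-cong (λ i → trans (cong (λ x → P i ∧ P x) (identityʳ i)) (∧-≡ˡ (λ Pi → Pi)))

  module _ {c} (φ : AffineMap c) where

    ∣∣-∘to : ∀ P → ∣ P ∘ to φ ∣ ≡ ∣ P ∣
    ∣∣-∘to P = sum-∘to φ (⟦_⟧ ∘ P)

    eqC-to : ∀ i j → eqC n (to φ i) j ≡ eqC n i (from φ j)
    eqC-to i j = Bool-ext
      (λ eq → ≡⇒⌊≟⌋ (trans (sym (AffineMap.from-to φ i)) (cong (from φ) (⌊≟⌋-sound eq))))
      (λ eq → ≡⇒⌊≟⌋ (trans (cong (to φ) (⌊≟⌋-sound eq)) (AffineMap.to-from φ j)))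

    module _ {H : SubC n} (H-subgroup : IsSubgroupA n H) (Hc : H c ≡ true) where

      private
        H-to : ∀ i → H (to φ i) ≡ H i
        H-to = to-coset φ H-subgroup Hc

      correlation-puncturedˡ : ∀ X → (∀ i → X i ≡ true → H i ≡ true) → correlation (punctured H) X φ + ⟦ X c ⟧ ≡ ∣ X ∣
      correlation-puncturedˡ X X⊆H = begin
        correlation (punctured H) X φ + ⟦ X c ⟧               ≡⟨ cong (_+ ⟦ X c ⟧) (∣∣-cong pointwise) ⟩
        ∣ (λ i → X (to φ i) ∧ not (eqC n (to φ i) c)) ∣ + ⟦ X c ⟧ ≡⟨ cong (_+ ⟦ X c ⟧) (∣∣-∘to (λ j → X j ∧ not (eqC n j c))) ⟩
        ∣ (λ j → X j ∧ not (eqC n j c)) ∣ + ⟦ X c ⟧             ≡⟨ ∣∣-remove X c ⟩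
        ∣ X ∣                                                  ∎
        where
        open ≡-Reasoning
        from-c : from φ c ≡ 𝟘
        from-c = trans (cong (from φ) (sym (to-𝟘 φ))) (AffineMap.from-to φ 𝟘)
        pointwise : ∀ i → punctured H i ∧ X (to φ i) ≡ X (to φ i) ∧ not (eqC n (to φ i) c)
        pointwise i rewrite eqC-to i c | from-c = lemma (H i) (eqC n i 𝟘) (X (to φ i)) (λ Xφi → trans (sym (H-to i)) (X⊆H _ Xφi))
          where
          lemma : ∀ h z x → (x ≡ true → h ≡ true) → (h ∧ not z) ∧ x ≡ x ∧ not z
          lemma h z false _ = ∧-zeroʳ (h ∧ not z)
          lemma h z true x⇒h rewrite x⇒h refl = ∧-identityʳ (not z)

      correlation-puncturedʳ : ∀ X → (∀ i → X i ≡ true → H i ≡ true) → correlation X (punctured H) φ + ⟦ X (from φ 𝟘) ⟧ ≡ ∣ X ∣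
      correlation-puncturedʳ X X⊆H = trans (cong (_+ ⟦ X (from φ 𝟘) ⟧) (∣∣-cong pointwise)) (∣∣-remove X (from φ 𝟘))
        where
        pointwise : ∀ i → X i ∧ punctured H (to φ i) ≡ X i ∧ not (eqC n i (from φ 𝟘))
        pointwise i rewrite eqC-to i 𝟘 | H-to i = lemma (X i) (H i) (eqC n i (from φ 𝟘)) (X⊆H i)
          where
          lemma : ∀ x h z → (x ≡ true → h ≡ true) → x ∧ (h ∧ not z) ≡ x ∧ not z
          lemma false h z _ = refl
          lemma true h z x⇒h rewrite x⇒h refl = refl

      correlation-complementʳ : ∀ P Q → (∀ i → P i ≡ true → H i ≡ true) →
                                correlation P (H ∖ Q) φ + correlation P Q φ ≡ ∣ P ∣
      correlation-complementʳ P Q P⊆H = begin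
        correlation P (H ∖ Q) φ + correlation P Q φ   ≡⟨ +-comm _ (correlation P Q φ) ⟩
        correlation P Q φ + correlation P (H ∖ Q) φ   ≡⟨ cong (correlation P Q φ +_) (∣∣-cong pointwise) ⟩
        correlation P Q φ + ∣ (λ i → P i ∧ not (Q (to φ i))) ∣ ≡⟨ ∣∣-split P (Q ∘ to φ) ⟩
        ∣ P ∣                                         ∎
        where
        open ≡-Reasoning
        pointwise : ∀ i → P i ∧ (H ∖ Q) (to φ i) ≡ P i ∧ not (Q (to φ i))
        pointwise i rewrite H-to i = lemma (P i) (H i) (Q (to φ i)) (P⊆H i)
          where
          lemma : ∀ p h q → (p ≡ true → h ≡ true) → p ∧ (h ∧ not q) ≡ p ∧ not q
          lemma false h q _ = refl
          lemma true h q p⇒h rewrite p⇒h refl = refl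

      correlation-complementˡ : ∀ P Q → (∀ i → Q i ≡ true → H i ≡ true) →
                                correlation (H ∖ P) Q φ + correlation P Q φ ≡ ∣ Q ∣
      correlation-complementˡ P Q Q⊆H = begin
        correlation (H ∖ P) Q φ + correlation P Q φ
          ≡⟨ cong₂ _+_ (∣∣-cong pointwise) (∣∣-cong (λ i → ∧-comm (P i) (Q (to φ i)))) ⟩
        ∣ (λ i → Q (to φ i) ∧ not (P i)) ∣ + ∣ (λ i → Q (to φ i) ∧ P i) ∣
          ≡⟨ +-comm ∣ (λ i → Q (to φ i) ∧ not (P i)) ∣ _ ⟩
        ∣ (λ i → Q (to φ i) ∧ P i) ∣ + ∣ (λ i → Q (to φ i) ∧ not (P i)) ∣
          ≡⟨ ∣∣-split (Q ∘ to φ) P ⟩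
        ∣ Q ∘ to φ ∣ ≡⟨ ∣∣-∘to Q ⟩
        ∣ Q ∣ ∎
        where
        open ≡-Reasoning
        pointwise : ∀ i → (H ∖ P) i ∧ Q (to φ i) ≡ Q (to φ i) ∧ not (P i)
        pointwise i rewrite sym (H-to i) = lemma (H (to φ i)) (P i) (Q (to φ i)) (Q⊆H (to φ i))
          where
          lemma : ∀ h p q → (q ≡ true → h ≡ true) → (h ∧ not p) ∧ q ≡ q ∧ not p
          lemma h p false _ = ∧-zeroʳ (h ∧ not p)
          lemma h p true q⇒h rewrite q⇒h refl = ∧-identityʳ (not p)

  repCount≡correlation : ∀ D c → repCount n D c ≡ correlation D D (translation c)
  repCount≡correlation D c = begin
    repCount n D c
      ≡⟨ length-filter _ (cartesianProduct (allC n) (allC n)) ⟩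
    listSum (cartesianProduct (allC n) (allC n)) (λ pq → ⟦ D (proj₁ pq) ∧ D (proj₂ pq) ∧ eqC n (⊖ proj₁ pq ⊕ proj₂ pq) c ⟧)
      ≡⟨ listSum-cartesianProduct (allC n) (allC n) _ ⟩
    listSum (allC n) (λ p → listSum (allC n) (λ q → ⟦ D p ∧ D q ∧ eqC n (⊖ p ⊕ q) c ⟧))
      ≡⟨ listSum-tabulate (λ i → i) (λ p → listSum (allC n) (λ q → ⟦ D p ∧ D q ∧ eqC n (⊖ p ⊕ q) c ⟧)) ⟩
    ∑[ p < n ] listSum (allC n) (λ q → ⟦ D p ∧ D q ∧ eqC n (⊖ p ⊕ q) c ⟧)
      ≡⟨ sum-cong-≗ (λ p → trans (listSum-tabulate (λ i → i) (λ q → ⟦ D p ∧ D q ∧ eqC n (⊖ p ⊕ q) c ⟧)) (fibre (D p) p)) ⟩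
    correlation D D (translation c) ∎
    where
    open ≡-Reasoning
    fibre : ∀ d p → ∑[ q < n ] ⟦ d ∧ D q ∧ eqC n (⊖ p ⊕ q) c ⟧ ≡ ⟦ d ∧ D (p ⊕ c) ⟧
    fibre false p = sum-replicate-zero n
    fibre true p = trans (sum-single _ (p ⊕ c) off-diagonal) (⟦∧true⟧ (D (p ⊕ c)) (≡⇒⌊≟⌋ (\\-leftDividesʳ p c)))
      where
      off-diagonal : ∀ q → ¬ (q ≡ p ⊕ c) → ⟦ D q ∧ eqC n (⊖ p ⊕ q) c ⟧ ≡ 0
      off-diagonal q q≢p⊕c = ⟦∧false⟧ (D q) (⌊≟⌋-≢ (λ eq → q≢p⊕c (trans (sym (\\-leftDividesˡ p q)) (cong (p ⊕_) eq))))

  convolution : SubD n → SubD n → Dih n → ℕ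
  convolution X Y g = sumD (λ p → ⟦ X p ∧ Y (mulD n (invD n p) g) ⟧)

  prodCoeff≡convolution : ∀ X Y g → prodCoeff n X Y g ≡ convolution X Y g
  prodCoeff≡convolution X Y g = begin
    prodCoeff n X Y g
      ≡⟨ length-filter _ (cartesianProduct (allD n) (allD n)) ⟩
    listSum (cartesianProduct (allD n) (allD n)) (λ pq → ⟦ X (proj₁ pq) ∧ Y (proj₂ pq) ∧ eqD n (mulD n (proj₁ pq) (proj₂ pq)) g ⟧)
      ≡⟨ listSum-cartesianProduct (allD n) (allD n) _ ⟩
    listSum (allD n) (λ p → listSum (allD n) (λ q → ⟦ X p ∧ Y q ∧ eqD n (mulD n p q) g ⟧))
      ≡⟨ listSum-allD _ ⟩
    sumD (λ p → listSum (allD n) (λ q → ⟦ X p ∧ Y q ∧ eqD n (mulD n p q) g ⟧))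
      ≡⟨ sumD-cong (λ p → trans (listSum-allD (λ q → ⟦ X p ∧ Y q ∧ eqD n (mulD n p q) g ⟧)) (fibre (X p) p)) ⟩
    convolution X Y g ∎
    where
    open ≡-Reasoning
    fibre : ∀ x p → sumD (λ q → ⟦ x ∧ Y q ∧ eqD n (mulD n p q) g ⟧) ≡ ⟦ x ∧ Y (mulD n (invD n p) g) ⟧
    fibre false p = sumD-zero (λ _ → refl)
    fibre true p = trans (sumD-single _ q₀ off-q₀) (⟦∧true⟧ (Y q₀) (trans (cong (λ h → eqD n h g) (mulD-cancelʳ p g)) (eqD-refl g)))
      where
      q₀ = mulD n (invD n p) g
      off-q₀ : ∀ q → ¬ (q ≡ q₀) → ⟦ Y q ∧ eqD n (mulD n p q) g ⟧ ≡ 0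
      off-q₀ q q≢q₀ with eqD n (mulD n p q) g in pq≡g
      ... | true = ⊥-elim (q≢q₀ (trans (sym (mulD-cancelˡ p q)) (cong (mulD n (invD n p)) (eqD-sound pq≡g))))
      ... | false = ⟦∧false⟧ (Y q) refl

  convolution-cong : ∀ {X X′ Y Y′ : SubD n} → (∀ p → X p ≡ X′ p) → (∀ p → Y p ≡ Y′ p) →
                     ∀ g → convolution X Y g ≡ convolution X′ Y′ g
  convolution-cong X≗X′ Y≗Y′ g = sumD-cong (λ p → cong₂ (λ x y → ⟦ x ∧ y ⟧) (X≗X′ p) (Y≗Y′ (mulD n (invD n p) g)))

  convolution-pointwise : ∀ X Y {Z : SubD n} g → (∀ p → X p ∧ Y (mulD n (invD n p) g) ≡ Z p) → convolution X Y g ≡ ∣ Z ∣ᴰ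
  convolution-pointwise X Y g eq = sumD-cong (cong ⟦_⟧ ∘ eq)

  convolution-identityˡ : ∀ Y g → convolution (λ p → eqD n p (eD n)) Y g ≡ ⟦ Y g ⟧
  convolution-identityˡ Y g =
    trans (sumD-single _ (eD n) off-e) (trans (cong (λ b → ⟦ b ∧ Y (mulD n (invD n (eD n)) g) ⟧) (eqD-refl (eD n)))
                                              (cong (⟦_⟧ ∘ Y) (eD⁻¹-mul g)))
    where
    off-e : ∀ p → ¬ (p ≡ eD n) → ⟦ eqD n p (eD n) ∧ Y (mulD n (invD n p) g) ⟧ ≡ 0
    off-e p p≢e = cong (λ b → ⟦ b ∧ Y (mulD n (invD n p) g) ⟧) (≢true⇒≡false (p≢e ∘ eqD-sound))

  convolution-identityʳ : ∀ Y g → convolution Y (λ p → eqD n p (eD n)) g ≡ ⟦ Y g ⟧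
  convolution-identityʳ Y g =
    trans (sumD-single _ g off-g) (⟦∧true⟧ (Y g) (trans (cong (λ h → eqD n h (eD n)) (mulD-inverseˡ g)) (eqD-refl (eD n))))
    where
    off-g : ∀ p → ¬ (p ≡ g) → ⟦ Y p ∧ eqD n (mulD n (invD n p) g) (eD n) ⟧ ≡ 0
    off-g p p≢g = ⟦∧false⟧ (Y p) (≢true⇒≡false (p≢g ∘ solve ∘ eqD-sound))
      where
      solve : mulD n (invD n p) g ≡ eD n → p ≡ g
      solve eq = sym (trans (sym (mulD-cancelʳ p g)) (trans (cong (mulD n p) eq) (mulD-identityʳ p)))

  rotationPart reflectionPart : SubD n → SubC n
  rotationPart X i = X (false , i)
  reflectionPart X i = X (true , i)

  -- (x^i)⁻¹ x^c = x^(c − i) and (y x^i)⁻¹ x^c = y x^(i + c).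
  convolution-rotation : ∀ X Y c → convolution X Y (false , c) ≡
    correlation (rotationPart X) (rotationPart Y) (reflection c) + correlation (reflectionPart X) (reflectionPart Y) (translation c)
  convolution-rotation X Y c = refl

  convolution-reflection : ∀ X Y c → convolution X Y (true , c) ≡
    correlation (rotationPart X) (reflectionPart Y) (translation c) + correlation (reflectionPart X) (rotationPart Y) (reflection c)
  convolution-reflection X Y c =
    cong (_+ correlation (reflectionPart X) (rotationPart Y) (reflection c))
         (sum-cong-≗ (λ i → cong (λ x → ⟦ X (false , i) ∧ Y (true , x ⊕ c) ⟧) (⁻¹-involutive i)))

  rotations reflections : SubC n → SubD n
  rotations P (false , i) = P i
  rotations P (true , _) = false
  reflections P (false , _) = false
  reflections P (true , i) = P i

  private
    ∅ : SubC n
    ∅ _ = false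

    correlation-∅∅ : ∀ {c} (φ : AffineMap c) → correlation ∅ ∅ φ ≡ 0
    correlation-∅∅ = correlation-emptyˡ ∅

  module _ (P Q : SubC n) (c : Fin n) where

    rotations-rotations : convolution (rotations P) (rotations Q) (false , c) ≡ correlation P Q (reflection c)
    rotations-rotations = trans (convolution-rotation (rotations P) (rotations Q) c) (+-≡ˡ refl (correlation-∅∅ (translation c)))

    rotations-rotations-reflection : convolution (rotations P) (rotations Q) (true , c) ≡ 0
    rotations-rotations-reflection =
      trans (convolution-reflection (rotations P) (rotations Q) c) (+-≡ˡ (correlation-emptyʳ P (translation c)) (correlation-∅∅ (reflection c)))

    rotations-reflections : convolution (rotations P) (reflections Q) (true , c) ≡ correlation P Q (translation c)
    rotations-reflections = trans (convolution-reflection (rotations P) (reflections Q) c) (+-≡ˡ refl (correlation-∅∅ (reflection c)))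

    rotations-reflections-rotation : convolution (rotations P) (reflections Q) (false , c) ≡ 0
    rotations-reflections-rotation = trans (convolution-rotation (rotations P) (reflections Q) c) $
      +-≡ˡ (correlation-emptyʳ P (reflection c)) (correlation-emptyˡ Q (translation c))

    reflections-rotations : convolution (reflections P) (rotations Q) (true , c) ≡ correlation P Q (reflection c)
    reflections-rotations = trans (convolution-reflection (reflections P) (rotations Q) c) (+-≡ʳ (correlation-∅∅ (translation c)) refl)

    reflections-rotations-rotation : convolution (reflections P) (rotations Q) (false , c) ≡ 0
    reflections-rotations-rotation = trans (convolution-rotation (reflections P) (rotations Q) c) $
      +-≡ˡ (correlation-emptyˡ Q (reflection c)) (correlation-emptyʳ P (translation c))

    reflections-reflections : convolution (reflections P) (reflections Q) (false , c) ≡ correlation P Q (translation c)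
    reflections-reflections = trans (convolution-rotation (reflections P) (reflections Q) c) $ +-≡ʳ (correlation-∅∅ (reflection c)) refl

    reflections-reflections-reflection : convolution (reflections P) (reflections Q) (true , c) ≡ 0
    reflections-reflections-reflection =
      trans (convolution-reflection (reflections P) (reflections Q) c) (+-≡ˡ (correlation-emptyˡ Q (translation c)) (correlation-emptyʳ P (reflection c)))

  sumD-translate : ∀ (F : Dih n → ℕ) g → sumD (λ p → F (mulD n (invD n p) g)) ≡ sumD F
  sumD-translate F (false , c) =
    cong₂ _+_ (sum-∘to (reflection c) (F ∘ (false ,_))) (sum-∘to (translation c) (F ∘ (true ,_)))
  sumD-translate F (true , c) = begin
    ∑[ i < n ] F (true , ⊖ ⊖ i ⊕ c) + ∑[ i < n ] F (false , ⊖ i ⊕ c)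
      ≡⟨ cong (_+ ∑[ i < n ] F (false , ⊖ i ⊕ c)) (sum-cong-≗ (λ i → cong (λ x → F (true , x ⊕ c)) (⁻¹-involutive i))) ⟩
    ∑[ i < n ] F (true , i ⊕ c) + ∑[ i < n ] F (false , ⊖ i ⊕ c)
      ≡⟨ cong₂ _+_ (sum-∘to (translation c) (F ∘ (true ,_))) (sum-∘to (reflection c) (F ∘ (false ,_))) ⟩
    ∑[ i < n ] F (true , i) + ∑[ i < n ] F (false , i)
      ≡⟨ +-comm (∑[ i < n ] F (true , i)) _ ⟩
    sumD F ∎
    where open ≡-Reasoning

  _·B : SubC n → SubD n
  (H ·B) (_ , i) = H i

  module _ {H : SubC n} (H-subgroup : IsSubgroupA n H) where
    open IsSubgroupA H-subgroup using (closedNeg)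

    private
      G₀ N : SubD n
      G₀ = H ·B
      N = not ∘ G₀

    ·B-quotientˡ : ∀ p g → G₀ p ≡ true → G₀ (mulD n (invD n p) g) ≡ G₀ g
    ·B-quotientˡ (false , i) (false , c) Hi = H-cosetˡ H-subgroup c (closedNeg i Hi)
    ·B-quotientˡ (false , i) (true , c) Hi =
      trans (cong (λ x → H (x ⊕ c)) (⁻¹-involutive i)) (H-cosetˡ H-subgroup c Hi)
    ·B-quotientˡ (true , i) (false , c) Hi = H-cosetˡ H-subgroup c Hi
    ·B-quotientˡ (true , i) (true , c) Hi = H-cosetˡ H-subgroup c (closedNeg i Hi)

    ·B-quotientʳ : ∀ p g → G₀ g ≡ true → G₀ (mulD n (invD n p) g) ≡ G₀ p
    ·B-quotientʳ (false , i) (false , c) Hc = to-coset (reflection c) H-subgroup Hc i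
    ·B-quotientʳ (false , i) (true , c) Hc =
      trans (cong (λ x → H (x ⊕ c)) (⁻¹-involutive i)) (to-coset (translation c) H-subgroup Hc i)
    ·B-quotientʳ (true , i) (false , c) Hc = to-coset (translation c) H-subgroup Hc i
    ·B-quotientʳ (true , i) (true , c) Hc = to-coset (reflection c) H-subgroup Hc i

    module _ {X : SubD n} (X⊆G₀ : ∀ p → X p ≡ true → G₀ p ≡ true) where

      convolution-outsideG₀ : ∀ {Y} → (∀ p → Y p ≡ true → G₀ p ≡ true) →
                              ∀ g → G₀ g ≡ false → convolution X Y g ≡ 0
      convolution-outsideG₀ {Y} Y⊆G₀ g g∉G₀ = trans (convolution-pointwise X Y g pointwise) (sumD-zero (λ _ → refl))
        where
        pointwise : ∀ p → X p ∧ Y (mulD n (invD n p) g) ≡ false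
        pointwise p = ∧-≡false (λ Xp → contra-≡false (λ Yq → trans (sym (·B-quotientˡ p g (X⊆G₀ p Xp))) (Y⊆G₀ _ Yq)) g∉G₀)

      convolution-Nʳ-inside : ∀ g → G₀ g ≡ true → convolution X N g ≡ 0
      convolution-Nʳ-inside g g∈G₀ = trans (convolution-pointwise X N g pointwise) (sumD-zero (λ _ → refl))
        where
        pointwise : ∀ p → X p ∧ N (mulD n (invD n p) g) ≡ false
        pointwise p = ∧-≡false (λ Xp → cong not (trans (·B-quotientˡ p g (X⊆G₀ p Xp)) g∈G₀))

      convolution-Nʳ-outside : ∀ g → G₀ g ≡ false → convolution X N g ≡ ∣ X ∣ᴰ
      convolution-Nʳ-outside g g∉G₀ = convolution-pointwise X N g pointwise
        where
        pointwise : ∀ p → X p ∧ N (mulD n (invD n p) g) ≡ X p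
        pointwise p = ∧-≡ˡ (λ Xp → cong not (trans (·B-quotientˡ p g (X⊆G₀ p Xp)) g∉G₀))

      convolution-Nˡ-inside : ∀ g → G₀ g ≡ true → convolution N X g ≡ 0
      convolution-Nˡ-inside g g∈G₀ = trans (convolution-pointwise N X g pointwise) (sumD-zero (λ _ → refl))
        where
        pointwise : ∀ p → N p ∧ X (mulD n (invD n p) g) ≡ false
        pointwise p = ∧-≡false (λ ¬G₀p → contra-≡false (λ Xq → trans (sym (·B-quotientʳ p g g∈G₀)) (X⊆G₀ _ Xq))
                                                 (trans (sym (not-involutive (G₀ p))) (cong not ¬G₀p)))

      convolution-Nˡ-outside : ∀ g → G₀ g ≡ false → convolution N X g ≡ ∣ X ∣ᴰ
      convolution-Nˡ-outside g g∉G₀ =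
        trans (convolution-pointwise N X g pointwise) (sumD-translate (⟦_⟧ ∘ X) g)
        where
        pointwise : ∀ p → N p ∧ X (mulD n (invD n p) g) ≡ X (mulD n (invD n p) g)
        pointwise p = ∧-≡ʳ (λ Xq → cong not (contra-≡false (λ G₀p → trans (sym (·B-quotientˡ p g G₀p)) (X⊆G₀ _ Xq)) g∉G₀))

    convolution-NN-inside : ∀ g → G₀ g ≡ true → convolution N N g ≡ ∣ N ∣ᴰ
    convolution-NN-inside g g∈G₀ = convolution-pointwise N N g (λ p → ∧-≡ˡ (trans (cong not (·B-quotientʳ p g g∈G₀))))
    -- p and p⁻¹g cannot both lie in G₀, and p⁻¹g runs over G₀ for |G₀| values of p.
    convolution-NN-outside : ∀ g → G₀ g ≡ false → convolution N N g + ∣ G₀ ∣ᴰ ≡ ∣ N ∣ᴰ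
    convolution-NN-outside g g∉G₀ = begin
      convolution N N g + ∣ G₀ ∣ᴰ
        ≡⟨ cong (convolution N N g +_) (sumD-translate (⟦_⟧ ∘ G₀) g) ⟨
      convolution N N g + sumD (λ p → ⟦ G₀ (q p) ⟧)
        ≡⟨ sumD-distrib-+ (λ p → ⟦ N p ∧ N (q p) ⟧) (λ p → ⟦ G₀ (q p) ⟧) ⟨
      sumD (λ p → ⟦ N p ∧ N (q p) ⟧ + ⟦ G₀ (q p) ⟧)
        ≡⟨ sumD-cong pointwise ⟩
      ∣ N ∣ᴰ ∎
      where
      open ≡-Reasoning
      q : Dih n → Dih n
      q p = mulD n (invD n p) g
      pointwise : ∀ p → ⟦ N p ∧ N (q p) ⟧ + ⟦ G₀ (q p) ⟧ ≡ ⟦ N p ⟧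
      pointwise p = trans (cong (λ b → ⟦ N p ∧ N (q p) ⟧ + ⟦ b ⟧) (sym (∧-≡ʳ G₀q⇒Np)))
                          (trans (cong (λ b → ⟦ N p ∧ N (q p) ⟧ + ⟦ N p ∧ b ⟧) (sym (not-involutive (G₀ (q p)))))
                                 (⟦∧⟧+⟦∧not⟧ (N p) (N (q p))))
        where
        G₀q⇒Np : G₀ (q p) ≡ true → N p ≡ true
        G₀q⇒Np G₀q = cong not (contra-≡false (λ G₀p → trans (sym (·B-quotientˡ p g G₀p)) G₀q) g∉G₀)

  module Invariance {r} {Y : Fin r → SubD n} (Y-sring : IsSRing n r Y) where
    open IsSRing Y-sring using (nonempty; cover; disjoint; product)

    classY : Dih n → Fin r
    classY g = proj₁ (cover g)

    classY-unique : ∀ a g → Y a g ≡ true → a ≡ classY g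
    classY-unique a g Yag = disjoint a (classY g) g Yag (proj₂ (cover g))

    Invariant : {A : Set} → (Dih n → A) → Set
    Invariant f = ∀ g h → classY g ≡ classY h → f g ≡ f h

    union⇒invariant : ∀ {W} → IsUnionOf n r Y W → Invariant W
    union⇒invariant {W} W-union g h same = Bool-ext (inherit g h same) (inherit h g (sym same))
      where
      inherit : ∀ g h → classY g ≡ classY h → W g ≡ true → W h ≡ true
      inherit g h same Wg = let a , Yag , Ya⊆W = W-union g Wg in
        Ya⊆W h (subst (λ b → Y b h ≡ true) (sym (trans (classY-unique a g Yag) same)) (proj₂ (cover h)))

    invariant⇒union : ∀ {W} → Invariant W → IsUnionOf n r Y W
    invariant⇒union {W} W-inv g Wg = classY g , proj₂ (cover g) ,
      λ h Yh → trans (W-inv h g (sym (classY-unique (classY g) h Yh))) Wg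

    invariant-≗ : ∀ {A : Set} {f f′ : Dih n → A} → (∀ g → f g ≡ f′ g) → Invariant f′ → Invariant f
    invariant-≗ f≗f′ f′-inv g h same = trans (f≗f′ g) (trans (f′-inv g h same) (sym (f≗f′ h)))

    invariant-∘ : ∀ {A B : Set} (φ : A → B) {f : Dih n → A} → Invariant f → Invariant (φ ∘ f)
    invariant-∘ φ f-inv g h same = cong φ (f-inv g h same)

    invariant-∧ : ∀ {f f′ : Dih n → Bool} → Invariant f → Invariant f′ → Invariant (λ g → f g ∧ f′ g)
    invariant-∧ f-inv f′-inv g h same = cong₂ _∧_ (f-inv g h same) (f′-inv g h same)

    representative : Fin r → Dih n
    representative a = proj₁ (nonempty a)

    private
      indicator-decomposition : ∀ {W} → Invariant W → ∀ p → ⟦ W p ⟧ ≡ ∑[ a < r ] (⟦ W (representative a) ⟧ * ⟦ Y a p ⟧)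
      indicator-decomposition {W} W-inv p = sym (trans
        (sum-indicator (λ a → ⟦ W (representative a) ⟧) (λ a → Y a p) (classY p) (proj₂ (cover p)) (λ a Yap → classY-unique a p Yap))
        (cong ⟦_⟧ (W-inv (representative (classY p)) p (sym (classY-unique _ _ (proj₂ (nonempty (classY p))))))))

      convolution-Y : ∀ a b g → convolution (Y a) (Y b) g ≡ proj₁ (product a b) (classY g)
      convolution-Y a b g = trans (sym (prodCoeff≡convolution (Y a) (Y b) g)) (trans (proj₂ (product a b) g)
        (sumFin-indicator (proj₁ (product a b)) (λ u → Y u g) (classY g) (proj₂ (cover g)) (λ u Yug → classY-unique u g Yug)))

    convolution-bilinear : ∀ {W W′} → Invariant W → Invariant W′ → ∀ g →
      convolution W W′ g ≡ ∑[ a < r ] ∑[ b < r ] (⟦ W (representative a) ⟧ * ⟦ W′ (representative b) ⟧ * convolution (Y a) (Y b) g)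
    convolution-bilinear {W} {W′} W-inv W′-inv g = begin
      sumD (λ p → ⟦ W p ∧ W′ (q p) ⟧)
        ≡⟨ sumD-cong (λ p → trans (⟦∧⟧ (W p) (W′ (q p))) (cong₂ _*_ (indicator-decomposition W-inv p) (indicator-decomposition W′-inv (q p)))) ⟩
      sumD (λ p → ∑[ a < r ] (w a * y a p) * ∑[ b < r ] (w′ b * y b (q p)))
        ≡⟨ sumD-cong (λ p → sum-*-sum (λ a → w a * y a p) (λ b → w′ b * y b (q p))) ⟩
      sumD (λ p → ∑[ a < r ] ∑[ b < r ] (w a * y a p * (w′ b * y b (q p))))
        ≡⟨ sumD-∑ (λ a p → ∑[ b < r ] (w a * y a p * (w′ b * y b (q p)))) ⟩
      ∑[ a < r ] sumD (λ p → ∑[ b < r ] (w a * y a p * (w′ b * y b (q p))))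
        ≡⟨ sum-cong-≗ (λ a → sumD-∑ (λ b p → w a * y a p * (w′ b * y b (q p)))) ⟩
      ∑[ a < r ] ∑[ b < r ] sumD (λ p → w a * y a p * (w′ b * y b (q p)))
        ≡⟨ sum-cong-≗ (λ a → sum-cong-≗ (λ b →
             trans (sumD-cong (rearrange a b)) (sumD-*ˡ (w a * w′ b) (λ p → ⟦ Y a p ∧ Y b (q p) ⟧)))) ⟩
      ∑[ a < r ] ∑[ b < r ] (w a * w′ b * convolution (Y a) (Y b) g) ∎
      where
      open ≡-Reasoning
      q : Dih n → Dih n
      q p = mulD n (invD n p) g
      w w′ : Fin r → ℕ
      w a = ⟦ W (representative a) ⟧
      w′ b = ⟦ W′ (representative b) ⟧
      y : Fin r → Dih n → ℕ
      y a p = ⟦ Y a p ⟧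
      rearrange : ∀ a b p → w a * y a p * (w′ b * y b (q p)) ≡ w a * w′ b * ⟦ Y a p ∧ Y b (q p) ⟧
      rearrange a b p = trans (interchange (w a) (y a p) (w′ b) (y b (q p))) (cong (w a * w′ b *_) (sym (⟦∧⟧ (Y a p) (Y b (q p)))))

    convolution-invariant : ∀ {W W′} → Invariant W → Invariant W′ → Invariant (convolution W W′)
    convolution-invariant {W} {W′} W-inv W′-inv g h same = begin
      convolution W W′ g
        ≡⟨ convolution-bilinear W-inv W′-inv g ⟩
      ∑[ a < r ] ∑[ b < r ] (⟦ W (representative a) ⟧ * ⟦ W′ (representative b) ⟧ * convolution (Y a) (Y b) g)
        ≡⟨ sum-cong-≗ (λ a → sum-cong-≗ (λ b → cong (⟦ W (representative a) ⟧ * ⟦ W′ (representative b) ⟧ *_)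
             (trans (convolution-Y a b g) (trans (cong (proj₁ (product a b)) same) (sym (convolution-Y a b h)))))) ⟩
      ∑[ a < r ] ∑[ b < r ] (⟦ W (representative a) ⟧ * ⟦ W′ (representative b) ⟧ * convolution (Y a) (Y b) h)
        ≡⟨ convolution-bilinear W-inv W′-inv h ⟨
      convolution W W′ h ∎
      where open ≡-Reasoning

  byClass : ℕ → ℕ → ℕ → ℕ → ℕ → Fin 5 → ℕ
  byClass x₀ x₁ x₂ x₃ x₄ 0F = x₀
  byClass x₀ x₁ x₂ x₃ x₄ 1F = x₁
  byClass x₀ x₁ x₂ x₃ x₄ 2F = x₂
  byClass x₀ x₁ x₂ x₃ x₄ 3F = x₃
  byClass x₀ x₁ x₂ x₃ x₄ 4F = x₄

  module BasicSets {A0 D : SubC n} {l k lam : ℕ} (ds : IsDifferenceSet n A0 D l k lam) where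
    open IsDifferenceSet ds using (H-subgroup; H-order; D⊆H; D-size; λ-pos; reps)
    open IsSubgroupA H-subgroup using (hasZero)

    X : Fin 5 → SubD n
    X = basicSets n A0 D

    G₀ N : SubD n
    G₀ = A0 ·B
    N = not ∘ G₀

    E : SubC n
    E = A0 ∖ D

    data Class : Dih n → Set where
      identity : Class (false , 𝟘)
      rotation : ∀ {c} → A0 c ≡ true → eqC n c 𝟘 ≡ false → Class (false , c)
      reflectionD : ∀ {c} → D c ≡ true → Class (true , c)
      reflectionE : ∀ {c} → A0 c ≡ true → D c ≡ false → Class (true , c)
      outside : ∀ {b c} → A0 c ≡ false → Class (b , c)

    classify : ∀ g → Class g
    classify (false , c) with eqC n c 𝟘 in c≟𝟘 | A0 c in c∈A0
    ... | true | _ = subst (λ x → Class (false , x)) (sym (⌊≟⌋-sound c≟𝟘)) identity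
    ... | false | true = rotation c∈A0 c≟𝟘
    ... | false | false = outside c∈A0
    classify (true , c) with D c in c∈D | A0 c in c∈A0
    ... | true | _ = reflectionD c∈D
    ... | false | true = reflectionE c∈A0 c∈D
    ... | false | false = outside c∈A0

    index : ∀ {g} → Class g → Fin 5
    index identity = 0F
    index (rotation _ _) = 1F
    index (reflectionD _) = 2F
    index (reflectionE _ _) = 3F
    index (outside _) = 4F

    membership : ∀ {g} (v : Class g) t → X t g ≡ ⌊ t ≟F index v ⌋
    membership identity 0F = ⌊≟⌋-refl 𝟘
    membership identity 1F = trans (cong (λ b → A0 𝟘 ∧ not b) (⌊≟⌋-refl 𝟘)) (∧-zeroʳ (A0 𝟘))
    membership identity 2F = refl
    membership identity 3F = refl
    membership identity 4F = cong not hasZero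
    membership (rotation c∈A0 c≢𝟘) 0F = c≢𝟘
    membership (rotation c∈A0 c≢𝟘) 1F = cong₂ (λ a z → a ∧ not z) c∈A0 c≢𝟘
    membership (rotation c∈A0 c≢𝟘) 2F = refl
    membership (rotation c∈A0 c≢𝟘) 3F = refl
    membership (rotation c∈A0 c≢𝟘) 4F = cong not c∈A0
    membership (reflectionD c∈D) 0F = refl
    membership (reflectionD c∈D) 1F = refl
    membership (reflectionD c∈D) 2F = c∈D
    membership (reflectionD c∈D) 3F = cong₂ (λ a d → a ∧ not d) (D⊆H _ c∈D) c∈D
    membership (reflectionD c∈D) 4F = cong not (D⊆H _ c∈D)
    membership (reflectionE c∈A0 c∉D) 0F = refl
    membership (reflectionE c∈A0 c∉D) 1F = refl
    membership (reflectionE c∈A0 c∉D) 2F = c∉D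
    membership (reflectionE c∈A0 c∉D) 3F = cong₂ (λ a d → a ∧ not d) c∈A0 c∉D
    membership (reflectionE c∈A0 c∉D) 4F = cong not c∈A0
    membership (outside {false} c∉A0) 0F = contra-≡false (λ c≟𝟘 → subst (λ x → A0 x ≡ true) (sym (⌊≟⌋-sound c≟𝟘)) hasZero) c∉A0
    membership (outside {false} c∉A0) 1F = cong (λ a → a ∧ _) c∉A0
    membership (outside {false} c∉A0) 2F = refl
    membership (outside {false} c∉A0) 3F = refl
    membership (outside {true} c∉A0) 0F = refl
    membership (outside {true} c∉A0) 1F = refl
    membership (outside {true} c∉A0) 2F = contra-≡false (D⊆H _) c∉A0
    membership (outside {true} c∉A0) 3F = cong (λ a → a ∧ _) c∉A0
    membership (outside {b} c∉A0) 4F = cong not c∉A0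

    correlation-DD : ∀ {c} → A0 c ≡ true → eqC n c 𝟘 ≡ false → correlation D D (translation c) ≡ lam
    correlation-DD {c} c∈A0 c≢𝟘 = trans (sym (repCount≡correlation D c)) (reps c c∈A0 c≢𝟘)

    correlation-DE-𝟘 : correlation D E (translation 𝟘) ≡ 0
    correlation-DE-𝟘 = trans (∸-from-+ (correlation-complementʳ (translation 𝟘) H-subgroup hasZero D D D⊆H) (correlation-self D)) (n∸n≡0 ∣ D ∣)

    correlation-DE : ∀ {c} → A0 c ≡ true → eqC n c 𝟘 ≡ false → correlation D E (translation c) ≡ ∣ D ∣ ∸ lam
    correlation-DE c∈A0 c≢𝟘 = ∸-from-+ (correlation-complementʳ (translation _) H-subgroup c∈A0 D D D⊆H) (correlation-DD c∈A0 c≢𝟘)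

    correlation-ED-𝟘 : correlation E D (translation 𝟘) ≡ 0
    correlation-ED-𝟘 = trans (∸-from-+ (correlation-complementˡ (translation 𝟘) H-subgroup hasZero D D D⊆H) (correlation-self D)) (n∸n≡0 ∣ D ∣)

    correlation-ED : ∀ {c} → A0 c ≡ true → eqC n c 𝟘 ≡ false → correlation E D (translation c) ≡ ∣ D ∣ ∸ lam
    correlation-ED c∈A0 c≢𝟘 = ∸-from-+ (correlation-complementˡ (translation _) H-subgroup c∈A0 D D D⊆H) (correlation-DD c∈A0 c≢𝟘)

    correlation-EE : ∀ {c} → A0 c ≡ true → eqC n c 𝟘 ≡ false → correlation E E (translation c) ≡ ∣ E ∣ ∸ (∣ D ∣ ∸ lam)
    correlation-EE c∈A0 c≢𝟘 =
      ∸-from-+ (correlation-complementʳ (translation _) H-subgroup c∈A0 E D (λ i → ∧-trueˡ)) (correlation-ED c∈A0 c≢𝟘)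

    structureConstant : Fin 5 → Fin 5 → Fin 5 → ℕ
    structureConstant 0F t u = ⟦ ⌊ t ≟F u ⌋ ⟧
    structureConstant (suc s) 0F u = ⟦ ⌊ suc s ≟F u ⌋ ⟧
    structureConstant 1F 1F = byClass ∣ punctured A0 ∣ (∣ punctured A0 ∣ ∸ 1) 0 0 0
    structureConstant 1F 2F = byClass 0 0 (∣ D ∣ ∸ 1) ∣ D ∣ 0
    structureConstant 1F 3F = byClass 0 0 ∣ E ∣ (∣ E ∣ ∸ 1) 0
    structureConstant 2F 1F = byClass 0 0 (∣ D ∣ ∸ 1) ∣ D ∣ 0
    structureConstant 2F 2F = byClass ∣ D ∣ lam 0 0 0
    structureConstant 2F 3F = byClass 0 (∣ D ∣ ∸ lam) 0 0 0
    structureConstant 3F 1F = byClass 0 0 ∣ E ∣ (∣ E ∣ ∸ 1) 0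
    structureConstant 3F 2F = byClass 0 (∣ D ∣ ∸ lam) 0 0 0
    structureConstant 3F 3F = byClass ∣ E ∣ (∣ E ∣ ∸ (∣ D ∣ ∸ lam)) 0 0 0
    structureConstant 1F 4F = byClass 0 0 0 0 ∣ X 1F ∣ᴰ
    structureConstant 2F 4F = byClass 0 0 0 0 ∣ X 2F ∣ᴰ
    structureConstant 3F 4F = byClass 0 0 0 0 ∣ X 3F ∣ᴰ
    structureConstant 4F 1F = byClass 0 0 0 0 ∣ X 1F ∣ᴰ
    structureConstant 4F 2F = byClass 0 0 0 0 ∣ X 2F ∣ᴰ
    structureConstant 4F 3F = byClass 0 0 0 0 ∣ X 3F ∣ᴰ
    structureConstant 4F 4F = byClass ∣ N ∣ᴰ ∣ N ∣ᴰ ∣ N ∣ᴰ ∣ N ∣ᴰ (∣ N ∣ᴰ ∸ ∣ G₀ ∣ᴰ)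

    X⊆G₀ : ∀ t → ¬ (t ≡ 4F) → ∀ p → X t p ≡ true → G₀ p ≡ true
    X⊆G₀ 0F _ (false , c) c≟𝟘 = subst (λ x → A0 x ≡ true) (sym (⌊≟⌋-sound c≟𝟘)) hasZero
    X⊆G₀ 1F _ (false , c) c∈X₁ = ∧-trueˡ c∈X₁
    X⊆G₀ 2F _ (true , c) c∈D = D⊆H c c∈D
    X⊆G₀ 3F _ (true , c) c∈E = ∧-trueˡ c∈E
    X⊆G₀ 4F t≢4 _ _ = ⊥-elim (t≢4 refl)

    X₄≗N : ∀ p → X 4F p ≡ N p
    X₄≗N (_ , _) = refl

    byG₀ : ∀ {g} (v : Class g) {w x y : ℕ} → (G₀ g ≡ true → w ≡ x) → (G₀ g ≡ false → w ≡ y) → w ≡ byClass x x x x y (index v)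
    byG₀ identity inside _ = inside hasZero
    byG₀ (rotation c∈A0 _) inside _ = inside c∈A0
    byG₀ (reflectionD c∈D) inside _ = inside (D⊆H _ c∈D)
    byG₀ (reflectionE c∈A0 _) inside _ = inside c∈A0
    byG₀ (outside c∉A0) _ outside′ = outside′ c∉A0

    private
      A0# = punctured A0
      A0#⊆A0 : ∀ i → A0# i ≡ true → A0 i ≡ true
      A0#⊆A0 i = ∧-trueˡ
      E⊆A0 : ∀ i → E i ≡ true → A0 i ≡ true
      E⊆A0 i = ∧-trueˡ

      vanishes-outside : ∀ s t → ¬ (s ≡ 4F) → ¬ (t ≡ 4F) → ∀ {b c} → A0 c ≡ false → convolution (X s) (X t) (b , c) ≡ 0
      vanishes-outside s t s≢4 t≢4 {b} {c} = convolution-outsideG₀ H-subgroup (X⊆G₀ s s≢4) (X⊆G₀ t t≢4) (b , c)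

      with-Nʳ : ∀ s → ¬ (s ≡ 4F) → ∀ {g} (v : Class g) → convolution (X s) (X 4F) g ≡ byClass 0 0 0 0 ∣ X s ∣ᴰ (index v)
      with-Nʳ s s≢4 {g} v = trans (convolution-cong {X = X s} {X′ = X s} (λ _ → refl) X₄≗N g)
        (byG₀ v (convolution-Nʳ-inside H-subgroup (X⊆G₀ s s≢4) g) (convolution-Nʳ-outside H-subgroup (X⊆G₀ s s≢4) g))

      with-Nˡ : ∀ t → ¬ (t ≡ 4F) → ∀ {g} (v : Class g) → convolution (X 4F) (X t) g ≡ byClass 0 0 0 0 ∣ X t ∣ᴰ (index v)
      with-Nˡ t t≢4 {g} v = trans (convolution-cong {Y = X t} {Y′ = X t} X₄≗N (λ _ → refl) g)
        (byG₀ v (convolution-Nˡ-inside H-subgroup (X⊆G₀ t t≢4) g) (convolution-Nˡ-outside H-subgroup (X⊆G₀ t t≢4) g))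

    convolution-basic : ∀ s t {g} (v : Class g) → convolution (X s) (X t) g ≡ structureConstant s t (index v)
    convolution-basic 0F t {g} v = trans (convolution-identityˡ (X t) g) (cong ⟦_⟧ (membership v t))
    convolution-basic s@(suc _) 0F {g} v = trans (convolution-identityʳ (X s) g) (cong ⟦_⟧ (membership v s))

    convolution-basic 1F 1F v@identity = trans (rotations-rotations A0# A0# 𝟘) $
      ∸-from-+ (correlation-puncturedˡ (reflection 𝟘) H-subgroup hasZero A0# A0#⊆A0) (cong ⟦_⟧ (membership v 1F))
    convolution-basic 1F 1F v@(rotation {c} c∈A0 _) = trans (rotations-rotations A0# A0# c) $
      ∸-from-+ (correlation-puncturedˡ (reflection c) H-subgroup c∈A0 A0# A0#⊆A0) (cong ⟦_⟧ (membership v 1F))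
    convolution-basic 1F 1F (reflectionD {c} _) = rotations-rotations-reflection A0# A0# c
    convolution-basic 1F 1F (reflectionE {c} _ _) = rotations-rotations-reflection A0# A0# c
    convolution-basic 1F 1F (outside {b} c∉A0) = vanishes-outside 1F 1F (λ ()) (λ ()) {b} c∉A0

    convolution-basic 1F 2F identity = rotations-reflections-rotation A0# D 𝟘
    convolution-basic 1F 2F (rotation {c} _ _) = rotations-reflections-rotation A0# D c
    convolution-basic 1F 2F v@(reflectionD {c} c∈D) = trans (rotations-reflections A0# D c) $
      ∸-from-+ (correlation-puncturedˡ (translation c) H-subgroup (D⊆H c c∈D) D D⊆H) (cong ⟦_⟧ (membership v 2F))
    convolution-basic 1F 2F v@(reflectionE {c} c∈A0 _) = trans (rotations-reflections A0# D c) $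
      ∸-from-+ (correlation-puncturedˡ (translation c) H-subgroup c∈A0 D D⊆H) (cong ⟦_⟧ (membership v 2F))
    convolution-basic 1F 2F (outside {b} c∉A0) = vanishes-outside 1F 2F (λ ()) (λ ()) {b} c∉A0

    convolution-basic 1F 3F identity = rotations-reflections-rotation A0# E 𝟘
    convolution-basic 1F 3F (rotation {c} _ _) = rotations-reflections-rotation A0# E c
    convolution-basic 1F 3F v@(reflectionD {c} c∈D) = trans (rotations-reflections A0# E c) $
      ∸-from-+ (correlation-puncturedˡ (translation c) H-subgroup (D⊆H c c∈D) E E⊆A0) (cong ⟦_⟧ (membership v 3F))
    convolution-basic 1F 3F v@(reflectionE {c} c∈A0 _) = trans (rotations-reflections A0# E c) $
      ∸-from-+ (correlation-puncturedˡ (translation c) H-subgroup c∈A0 E E⊆A0) (cong ⟦_⟧ (membership v 3F))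
    convolution-basic 1F 3F (outside {b} c∉A0) = vanishes-outside 1F 3F (λ ()) (λ ()) {b} c∉A0

    convolution-basic 2F 1F identity = reflections-rotations-rotation D A0# 𝟘
    convolution-basic 2F 1F (rotation {c} _ _) = reflections-rotations-rotation D A0# c
    convolution-basic 2F 1F v@(reflectionD {c} c∈D) = trans (reflections-rotations D A0# c) $
      ∸-from-+ (correlation-puncturedʳ (reflection c) H-subgroup (D⊆H c c∈D) D D⊆H)
               (trans (cong (⟦_⟧ ∘ D) (to-𝟘 (reflection c))) (cong ⟦_⟧ (membership v 2F)))
    convolution-basic 2F 1F v@(reflectionE {c} c∈A0 _) = trans (reflections-rotations D A0# c) $
      ∸-from-+ (correlation-puncturedʳ (reflection c) H-subgroup c∈A0 D D⊆H)
               (trans (cong (⟦_⟧ ∘ D) (to-𝟘 (reflection c))) (cong ⟦_⟧ (membership v 2F)))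
    convolution-basic 2F 1F (outside {b} c∉A0) = vanishes-outside 2F 1F (λ ()) (λ ()) {b} c∉A0

    convolution-basic 3F 1F identity = reflections-rotations-rotation E A0# 𝟘
    convolution-basic 3F 1F (rotation {c} _ _) = reflections-rotations-rotation E A0# c
    convolution-basic 3F 1F v@(reflectionD {c} c∈D) = trans (reflections-rotations E A0# c) $
      ∸-from-+ (correlation-puncturedʳ (reflection c) H-subgroup (D⊆H c c∈D) E E⊆A0)
               (trans (cong (⟦_⟧ ∘ E) (to-𝟘 (reflection c))) (cong ⟦_⟧ (membership v 3F)))
    convolution-basic 3F 1F v@(reflectionE {c} c∈A0 _) = trans (reflections-rotations E A0# c) $
      ∸-from-+ (correlation-puncturedʳ (reflection c) H-subgroup c∈A0 E E⊆A0)
               (trans (cong (⟦_⟧ ∘ E) (to-𝟘 (reflection c))) (cong ⟦_⟧ (membership v 3F)))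
    convolution-basic 3F 1F (outside {b} c∉A0) = vanishes-outside 3F 1F (λ ()) (λ ()) {b} c∉A0

    convolution-basic 2F 2F identity = trans (reflections-reflections D D 𝟘) (correlation-self D)
    convolution-basic 2F 2F (rotation {c} c∈A0 c≢𝟘) = trans (reflections-reflections D D c) (correlation-DD c∈A0 c≢𝟘)
    convolution-basic 2F 2F (reflectionD {c} _) = reflections-reflections-reflection D D c
    convolution-basic 2F 2F (reflectionE {c} _ _) = reflections-reflections-reflection D D c
    convolution-basic 2F 2F (outside {b} c∉A0) = vanishes-outside 2F 2F (λ ()) (λ ()) {b} c∉A0

    convolution-basic 2F 3F identity = trans (reflections-reflections D E 𝟘) correlation-DE-𝟘
    convolution-basic 2F 3F (rotation {c} c∈A0 c≢𝟘) = trans (reflections-reflections D E c) (correlation-DE c∈A0 c≢𝟘)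
    convolution-basic 2F 3F (reflectionD {c} _) = reflections-reflections-reflection D E c
    convolution-basic 2F 3F (reflectionE {c} _ _) = reflections-reflections-reflection D E c
    convolution-basic 2F 3F (outside {b} c∉A0) = vanishes-outside 2F 3F (λ ()) (λ ()) {b} c∉A0

    convolution-basic 3F 2F identity = trans (reflections-reflections E D 𝟘) correlation-ED-𝟘
    convolution-basic 3F 2F (rotation {c} c∈A0 c≢𝟘) = trans (reflections-reflections E D c) (correlation-ED c∈A0 c≢𝟘)
    convolution-basic 3F 2F (reflectionD {c} _) = reflections-reflections-reflection E D c
    convolution-basic 3F 2F (reflectionE {c} _ _) = reflections-reflections-reflection E D c
    convolution-basic 3F 2F (outside {b} c∉A0) = vanishes-outside 3F 2F (λ ()) (λ ()) {b} c∉A0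

    convolution-basic 3F 3F identity = trans (reflections-reflections E E 𝟘) (correlation-self E)
    convolution-basic 3F 3F (rotation {c} c∈A0 c≢𝟘) = trans (reflections-reflections E E c) (correlation-EE c∈A0 c≢𝟘)
    convolution-basic 3F 3F (reflectionD {c} _) = reflections-reflections-reflection E E c
    convolution-basic 3F 3F (reflectionE {c} _ _) = reflections-reflections-reflection E E c
    convolution-basic 3F 3F (outside {b} c∉A0) = vanishes-outside 3F 3F (λ ()) (λ ()) {b} c∉A0

    convolution-basic 1F 4F v = with-Nʳ 1F (λ ()) v
    convolution-basic 2F 4F v = with-Nʳ 2F (λ ()) v
    convolution-basic 3F 4F v = with-Nʳ 3F (λ ()) v
    convolution-basic 4F 1F v = with-Nˡ 1F (λ ()) v
    convolution-basic 4F 2F v = with-Nˡ 2F (λ ()) v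
    convolution-basic 4F 3F v = with-Nˡ 3F (λ ()) v
    convolution-basic 4F 4F {g} v = trans (convolution-cong X₄≗N X₄≗N g) $
      byG₀ v (convolution-NN-inside H-subgroup g) (λ g∉G₀ → ∸-from-+ (convolution-NN-outside H-subgroup g g∉G₀) refl)

    X-index : ∀ {g} (v : Class g) → X (index v) g ≡ true
    X-index v = trans (membership v (index v)) (⌊≟⌋-refl (index v))

    index-unique : ∀ t {g} (v : Class g) → X t g ≡ true → t ≡ index v
    index-unique t v Xtg = ⌊≟⌋-sound (trans (sym (membership v t)) Xtg)

    X-inverse : ∀ t g → X t g ≡ X t (invD n g)
    X-inverse t (true , c) = refl
    X-inverse 0F (false , c) = sym (eqC-⊖𝟘 c)
    X-inverse 1F (false , c) = sym (cong₂ (λ a z → a ∧ not z) (H-⊖ H-subgroup c) (eqC-⊖𝟘 c))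
    X-inverse 2F (false , c) = refl
    X-inverse 3F (false , c) = refl
    X-inverse 4F (false , c) = sym (cong not (H-⊖ H-subgroup c))

    isSRing : (∀ t → Σ (Dih n) (λ g → X t g ≡ true)) → IsSRing n 5 X
    isSRing nonempty = record
      { nonempty = nonempty
      ; cover = λ g → index (classify g) , X-index (classify g)
      ; disjoint = λ s t g Xsg Xtg → trans (index-unique s (classify g) Xsg) (sym (index-unique t (classify g) Xtg))
      ; identity = 0F , λ g → refl
      ; inverse = λ t → t , X-inverse t
      ; product = λ s t → structureConstant s t , λ g → begin
          prodCoeff n (X s) (X t) g
            ≡⟨ prodCoeff≡convolution (X s) (X t) g ⟩
          convolution (X s) (X t) g
            ≡⟨ convolution-basic s t (classify g) ⟩
          structureConstant s t (index (classify g))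
            ≡⟨ sumFin-indicator (structureConstant s t) (λ u → X u g) _ (X-index (classify g)) (λ u Xug → index-unique u (classify g) Xug) ⟨
          sumFin n 5 (λ u → structureConstant s t u * indic n (X u g)) ∎ }
      where open ≡-Reasoning

    T : SubD n
    T = Tset n A0 D

    inT : Fin 5 → Bool
    inT 0F = false
    inT 1F = true
    inT 2F = true
    inT 3F = false
    inT 4F = true

    T-membership : ∀ {g} (v : Class g) → T g ≡ inT (index v)
    T-membership identity = cong₂ (λ a z → (a ∧ not z) ∨ not a) hasZero (⌊≟⌋-refl 𝟘)
    T-membership (rotation c∈A0 c≢𝟘) = cong₂ (λ a z → (a ∧ not z) ∨ not a) c∈A0 c≢𝟘
    T-membership (reflectionD c∈D) = cong (_∨ _) c∈D
    T-membership (reflectionE c∈A0 c∉D) = cong₂ (λ d a → d ∨ not a) c∉D c∈A0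
    T-membership (outside {false} c∉A0) = cong (λ a → (a ∧ _) ∨ not a) c∉A0
    T-membership (outside {true} {c} c∉A0) = trans (cong (λ a → D c ∨ not a) c∉A0) (∨-zeroʳ (D c))

    T-union : IsUnionOf n 5 X T
    T-union g Tg = index (classify g) , X-index (classify g) , λ h Xh → begin
      T h                                ≡⟨ T-membership (classify h) ⟩
      inT (index (classify h))           ≡⟨ cong inT (index-unique _ (classify h) Xh) ⟨
      inT (index (classify g))           ≡⟨ T-membership (classify g) ⟨
      T g                                ≡⟨ Tg ⟩
      true                               ∎
      where open ≡-Reasoning

    module _ (∣E∣-pos : isPositive ∣ E ∣ ≡ true) (X₃X₃-pos : isPositive (∣ E ∣ ∸ (∣ D ∣ ∸ lam)) ≡ true) where

      X₃≡complement : ∀ g → X 3F g ≡ not (T g) ∧ not (X 0F g)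
      X₃≡complement g = trans (membership v 3F) (trans (by-index (index v))
                          (sym (cong₂ (λ t x → not t ∧ not x) (T-membership v) (membership v 0F))))
        where
        v = classify g
        by-index : ∀ u → ⌊ 3F ≟F u ⌋ ≡ not (inT u) ∧ not ⌊ 0F ≟F u ⌋
        by-index 0F = refl
        by-index 1F = refl
        by-index 2F = refl
        by-index 3F = refl
        by-index 4F = refl

      X₁≡support : ∀ g → X 1F g ≡ isPositive (convolution (X 3F) (X 3F) g) ∧ not (X 0F g)
      X₁≡support g = trans (membership v 1F) (trans (by-index (index v))
                       (sym (cong₂ (λ m x → isPositive m ∧ not x) (convolution-basic 3F 3F v) (membership v 0F))))
        where
        v = classify g
        by-index : ∀ u → ⌊ 1F ≟F u ⌋ ≡ isPositive (structureConstant 3F 3F u) ∧ not ⌊ 0F ≟F u ⌋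
        by-index 0F = sym (∧-zeroʳ _)
        by-index 1F = sym (trans (∧-identityʳ _) X₃X₃-pos)
        by-index 2F = refl
        by-index 3F = refl
        by-index 4F = refl

      X₂≡support : ∀ g → X 2F g ≡ isPositive (convolution (X 1F) (X 3F) g) ∧ not (X 3F g)
      X₂≡support g = trans (membership v 2F) (trans (by-index (index v))
                       (sym (cong₂ (λ m x → isPositive m ∧ not x) (convolution-basic 1F 3F v) (membership v 3F))))
        where
        v = classify g
        by-index : ∀ u → ⌊ 2F ≟F u ⌋ ≡ isPositive (structureConstant 1F 3F u) ∧ not ⌊ 3F ≟F u ⌋
        by-index 0F = refl
        by-index 1F = refl
        by-index 2F = sym (trans (∧-identityʳ _) ∣E∣-pos)
        by-index 3F = sym (∧-zeroʳ _)
        by-index 4F = refl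

      X₄≡remainder : ∀ g → X 4F g ≡ T g ∧ not (X 1F g) ∧ not (X 2F g)
      X₄≡remainder g = trans (membership v 4F) (trans (by-index (index v))
                         (sym (cong₂ (λ t x → t ∧ x) (T-membership v) (cong₂ (λ x y → not x ∧ not y) (membership v 1F) (membership v 2F)))))
        where
        v = classify g
        by-index : ∀ u → ⌊ 4F ≟F u ⌋ ≡ inT u ∧ not ⌊ 1F ≟F u ⌋ ∧ not ⌊ 2F ≟F u ⌋
        by-index 0F = refl
        by-index 1F = refl
        by-index 2F = refl
        by-index 3F = refl
        by-index 4F = refl

      module _ {r} {Y : Fin r → SubD n} (Y-sring : IsSRing n r Y) (T-Y-union : IsUnionOf n r Y T) where
        open Invariance Y-sring

        X₀-invariant : Invariant (X 0F)
        X₀-invariant = union⇒invariant λ g X₀g → let t₀ , Y-t₀≡ = IsSRing.identity Y-sring in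
          t₀ , trans (Y-t₀≡ g) X₀g , λ h Yh → trans (sym (Y-t₀≡ h)) Yh

        T-invariant : Invariant T
        T-invariant = union⇒invariant T-Y-union

        X₃-invariant : Invariant (X 3F)
        X₃-invariant = invariant-≗ X₃≡complement (invariant-∧ (invariant-∘ not T-invariant) (invariant-∘ not X₀-invariant))

        X₁-invariant : Invariant (X 1F)
        X₁-invariant = invariant-≗ X₁≡support
          (invariant-∧ (invariant-∘ isPositive (convolution-invariant X₃-invariant X₃-invariant)) (invariant-∘ not X₀-invariant))

        X₂-invariant : Invariant (X 2F)
        X₂-invariant = invariant-≗ X₂≡support
          (invariant-∧ (invariant-∘ isPositive (convolution-invariant X₁-invariant X₃-invariant)) (invariant-∘ not X₃-invariant))

        X₄-invariant : Invariant (X 4F)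
        X₄-invariant = invariant-≗ X₄≡remainder
          (invariant-∧ T-invariant (invariant-∧ (invariant-∘ not X₁-invariant) (invariant-∘ not X₂-invariant)))

        minimal : SRing⊆ n 5 X r Y
        minimal 0F = invariant⇒union X₀-invariant
        minimal 1F = invariant⇒union X₁-invariant
        minimal 2F = invariant⇒union X₂-invariant
        minimal 3F = invariant⇒union X₃-invariant
        minimal 4F = invariant⇒union X₄-invariant

    ∣D∣+∣E∣≡l : ∣ D ∣ + ∣ E ∣ ≡ l
    ∣D∣+∣E∣≡l = begin
      ∣ D ∣ + ∣ E ∣                         ≡⟨ cong (_+ ∣ E ∣) (∣∣-cong (λ i → sym (∧-≡ʳ (D⊆H i)))) ⟩
      ∣ (λ i → A0 i ∧ D i) ∣ + ∣ E ∣        ≡⟨ ∣∣-split A0 D ⟩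
      ∣ A0 ∣                                ≡⟨ sizeC≡∣∣ A0 ⟨
      sizeC n A0                            ≡⟨ H-order ⟩
      l                                     ∎
      where open ≡-Reasoning

    ∣A0#∣+1≡l : ∣ punctured A0 ∣ + 1 ≡ l
    ∣A0#∣+1≡l = trans (cong (λ b → ∣ punctured A0 ∣ + ⟦ b ⟧) (sym hasZero))
                      (trans (∣∣-remove A0 𝟘) (trans (sym (sizeC≡∣∣ A0)) H-order))

    λ≤∣D∣ : ∀ {c} → A0 c ≡ true → eqC n c 𝟘 ≡ false → lam ≤ ∣ D ∣
    λ≤∣D∣ {c} c∈A0 c≢𝟘 = ≤-trans (m≤n+m lam (correlation D E (translation c)))
      (≤-reflexive (trans (cong (correlation D E (translation c) +_) (sym (correlation-DD c∈A0 c≢𝟘)))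
                          (correlation-complementʳ (translation c) H-subgroup c∈A0 D D D⊆H)))

    module Sizes {m : ℕ} (2≤l : 2 ≤ l) (2≤m : 2 ≤ m) (m*l≡n : m * l ≡ n) (λ+l≡2k+2 : lam + l ≡ 2 * k + 2) where

      private
        ∣D∣≡k : ∣ D ∣ ≡ k
        ∣D∣≡k = trans (sym (sizeC≡∣∣ D)) D-size

        ∣A0#∣≢0 : ¬ (∣ punctured A0 ∣ ≡ 0)
        ∣A0#∣≢0 ∣A0#∣≡0 with subst (2 ≤_) (trans (sym ∣A0#∣+1≡l) (cong (_+ 1) ∣A0#∣≡0)) 2≤l
        ... | s≤s ()

        A0#-witness : ∃ λ c → punctured A0 c ≡ true
        A0#-witness = sum-witness (punctured A0) ∣A0#∣≢0

        ∣D∣≢0 : ¬ (∣ D ∣ ≡ 0)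
        ∣D∣≢0 ∣D∣≡0 = <-irrefl refl (≤-trans (+-mono-≤ λ-pos 2≤l)
                        (≤-reflexive (trans λ+l≡2k+2 (cong (λ x → 2 * x + 2) (trans (sym ∣D∣≡k) ∣D∣≡0)))))

        ∣outside∣≢0 : ¬ (∣ not ∘ A0 ∣ ≡ 0)
        ∣outside∣≢0 ∣outside∣≡0 = <-irrefl refl (begin-strict
          l            <⟨ m<m+n l (≤-trans (s≤s z≤n) 2≤l) ⟩
          l + l        ≡⟨ cong (l +_) (+-identityʳ l) ⟨
          2 * l        ≤⟨ *-monoˡ-≤ l 2≤m ⟩
          m * l        ≡⟨ m*l≡n ⟩
          n            ≡⟨ sum-ones n ⟨
          ∣ (λ _ → true) ∣            ≡⟨ ∣∣-split (λ _ → true) A0 ⟨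
          ∣ A0 ∣ + ∣ not ∘ A0 ∣       ≡⟨ cong₂ _+_ (trans (sym (sizeC≡∣∣ A0)) H-order) ∣outside∣≡0 ⟩
          l + 0        ≡⟨ +-identityʳ l ⟩
          l            ∎)
          where open ≤-Reasoning

      -- λ ≤ |D| is witnessed by any element of A0^#, which exists since l ≥ 2.
      ∣E∣≡∣D∣∸λ+2 : ∣ E ∣ ≡ (∣ D ∣ ∸ lam) + 2
      ∣E∣≡∣D∣∸λ+2 = let c , c∈A0# = A0#-witness in
        e≡d+2 ∣D∣+∣E∣≡l (m∸n+n≡m (λ≤∣D∣ (∧-trueˡ c∈A0#) (∧-not-true c∈A0#)))
              (trans λ+l≡2k+2 (cong (λ x → 2 * x + 2) (sym ∣D∣≡k)))

      ∣E∣-positive : isPositive ∣ E ∣ ≡ true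
      ∣E∣-positive = cong isPositive (trans ∣E∣≡∣D∣∸λ+2 (+-comm (∣ D ∣ ∸ lam) 2))

      X₃X₃-positive : isPositive (∣ E ∣ ∸ (∣ D ∣ ∸ lam)) ≡ true
      X₃X₃-positive = cong isPositive (trans (cong (_∸ (∣ D ∣ ∸ lam)) ∣E∣≡∣D∣∸λ+2) (m+n∸m≡n (∣ D ∣ ∸ lam) 2))

      X-nonempty : ∀ t → Σ (Dih n) (λ g → X t g ≡ true)
      X-nonempty 0F = (false , 𝟘) , ⌊≟⌋-refl 𝟘
      X-nonempty 1F = let c , c∈A0# = A0#-witness in (false , c) , c∈A0#
      X-nonempty 2F = let c , c∈D = sum-witness D ∣D∣≢0 in (true , c) , c∈D
      X-nonempty 3F = let c , c∈E = sum-witness E (λ ∣E∣≡0 → true≢false ∣E∣-positive (cong isPositive ∣E∣≡0)) in (true , c) , c∈E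
      X-nonempty 4F = let c , c∉A0 = sum-witness (not ∘ A0) ∣outside∣≢0 in (false , c) , c∉A0

lemma4p2 : (n : ℕ) .{{_ : NonZero n}} (A0 D : SubC n) (m l k s lam : ℕ)
    → IsSubgroupA n A0 → sizeC n A0 ≡ l → 2 ≤ l → 2 ≤ m → m * l ≡ n
    → s * s + 7 ≡ 8 * l → 2 * k + s + 1 ≡ 2 * l
    → lam + l ≡ 2 * k + 2
    → IsDifferenceSet n A0 D l k lam
    → IsWLClosure n (Tset n A0 D) 5 (basicSets n A0 D)
lemma4p2 n A0 D m l k s lam _ _ 2≤l 2≤m m*l≡n _ _ λ+l≡2k+2 ds = record
  { sring = isSRing X-nonempty
  ; contains = T-union
  ; smallest = λ r Y Y-sring T-Y-union → minimal ∣E∣-positive X₃X₃-positive Y-sring T-Y-union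
  }
  where
  open Dihedral n
  open BasicSets ds
  open Sizes 2≤l 2≤m m*l≡n λ+l≡2k+2
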